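{- Let $G$ be a connected graph with $n$ vertices, $\tau$ a set of types with $|\tau|>1$, $f:\tau\to\mathbb{Q}_{\ge1}$ a fitness function, and $D\in\mathcal D(G,\tau)$. Assume $\tau\setminus\tau_{\max}(f)\neq\emptyset$ and let $f^*=\max\{f(j): j\in\tau\setminus\tau_{\max}(f)\}$. Then for every $\alpha\in\tau_{\max}(f)$, $$\mathbb{E}(A_\alpha(G,\tau,f,D))\le(|\tau_{\max}(f)|-1)n^6+\frac{f(\alpha)}{f(\alpha)-f^*}(n+1)n^3.$$
   Context: $\tau_{\max}(f)=\{i: f(i)=\max_jf(j)\}$. $\Omega$ is the set of functions $V\to\tau$. For $S\in\Omega$, $S|_{v\to w}$ equals $S$ except that $w$ gets type $S(v)$. The Moran process $M(G,\tau,f,D)$ is the Markov chain on $\Omega$ with initial state $M_0$ drawn from $D$ in which, given $M_t$, a vertex $v$ is chosen with probability $f(M_t(v))/\sum_uf(M_t(u))$, then a uniformly random neighbour $w$ of $v$, and $M_{t+1}=M_t|_{v\to w}$. $V_j(t)=\{v:M_t(v)=j\}$ and $A_j(G,\tau,f,D)=\min\{t\in\mathbb{Z}_{\ge0}:V_j(t)=V\text{ or }V_j(t)=\emptyset\}$. With $k=|\tau|$, $V[k]$ is the set of $k$-tuples of distinct vertices, $\tau[k]$ the set of $k$-tuples of distinct types, and $\Omega(\mathbf u,\boldsymbol\gamma)$ the set of states mapping the $i$-th entry of $\mathbf u$ to the $i$-th entry of $\boldsymbol\gamma$ for all $i$. $\mathcal D(G,\tau)$ is the set of distributions $D$ on $\Omega$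 such that there are distributions $D_{\mathbf u,\boldsymbol\gamma}$ on $\Omega(\mathbf u,\boldsymbol\gamma)$ with $\Pr_D(S)=\frac{1}{|V[k]\times\tau[k]|}\sum_{(\mathbf u,\boldsymbol\gamma)\in V[k]\times\tau[k]}\Pr_{D_{\mathbf u,\boldsymbol\gamma}}(S)$ for all $S$.
   Formalization: The initial distribution D and the distributions $D_{\mathbf u,\boldsymbol\gamma}$ on $\Omega(\mathbf u,\boldsymbol\gamma)$ take rational values. -}

module Defs where

open import Data.Bool using (Bool; true; false; T; not; _∧_; _∨_; if_then_else_)
open import Data.Nat as ℕ using (ℕ; zero; suc)
open import Data.Fin as Fin using (Fin)
open import Data.Integer using (+_)
open import Data.List as List using (List; []; _∷_; map; concatMap; allFin; foldr; length; filter)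
open import Data.Bool.ListAction using (any; all)
open import Data.Vec as Vec using (Vec; []; _∷_; lookup; _[_]≔_; toList)
open import Data.Vec.Properties using (≡-dec)
open import Data.Product using (Σ; ∃; _×_; _,_)
open import Data.Rational as ℚ using (ℚ; 0ℚ; 1ℚ; _+_; _*_; _-_; _÷_; _≤_; _<_; _⊔_)
open import Data.Rational.Properties using (_≟_)
open import Relation.Nullary using (yes; no; does)
open import Relation.Nullary.Decidable using (⌊_⌋)
open import Relation.Binary.PropositionalEquality using (_≡_; _≢_)
open import Relation.Binary.Construct.Closure.ReflexiveTransitive using (Star)

ℕ→ℚ : ℕ → ℚ
ℕ→ℚ m = (+ m) ℚ./ 1

sumℚ : List ℚ → ℚ
sumℚ = foldr _+_ 0ℚ

Σ[_]_ : {A : Set} → List A → (A → ℚ) → ℚ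
Σ[ xs ] g = sumℚ (map g xs)

-- Division of rationals; returns 0 when the divisor is 0.
-- (Only ever used where the divisor is provably nonzero, or where a
--  zero divisor corresponds to a case the paper leaves undefined.)
_÷₀_ : ℚ → ℚ → ℚ
p ÷₀ q with q ≟ 0ℚ
... | yes _ = 0ℚ
... | no q≢0 = _÷_ p q {{ℚ.≢-nonZero q≢0}}

[_] : Bool → ℚ
[ b ] = if b then 1ℚ else 0ℚ

-- maximum of f over a list (0 for the empty list; only used on nonempty lists)
maxOver : {A : Set} → List A → (A → ℚ) → ℚ
maxOver [] f = 0ℚ
maxOver (x ∷ xs) f = foldr (λ y m → f y ⊔ m) (f x) xs

record Graph (n : ℕ) : Set where
  field
    adj       : Fin n → Fin n → Bool
    symmetric : ∀ u v → adj u v ≡ adj v u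
    loopless  : ∀ v → adj v v ≡ false

open Graph public

Connected : ∀ {n} → Graph n → Set
Connected G = ∀ u v → Star (λ a b → T (adj G a b)) u v

nbrs : ∀ {n} → Graph n → Fin n → List (Fin n)
nbrs {n} G v = filter (λ w → T? (adj G v w)) (allFin n)
  where
  open import Data.Bool.Properties using () renaming (T? to T?)

deg : ∀ {n} → Graph n → Fin n → ℕ
deg G v = length (nbrs G v)

-- States: Ω = functions V → τ, represented as Vec (Fin k) n

State : ℕ → ℕ → Set
State n k = Vec (Fin k) n

allVecs : (k n : ℕ) → List (Vec (Fin k) n)
allVecs k zero = [] ∷ []
allVecs k (suc n) = concatMap (λ x → map (x ∷_) (allVecs k n)) (allFin k)

eqState : ∀ {n k} → State n k → State n k → Bool
eqState S S' = ⌊ ≡-dec Fin._≟_ S S' ⌋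

eqFin : ∀ {k} → Fin k → Fin k → Bool
eqFin i j = ⌊ i Fin.≟ j ⌋

update : ∀ {n k} → State n k → Fin n → Fin n → State n k
update S v w = S [ w ]≔ lookup S v

IsDistribution : ∀ {n k} → (State n k → ℚ) → Set
IsDistribution {n} {k} D =
  (∀ S → 0ℚ ≤ D S) × (Σ[ allVecs k n ] D ≡ 1ℚ)

distinctL : ∀ {m} → List (Fin m) → Bool
distinctL [] = true
distinctL (x ∷ xs) = not (any (eqFin x) xs) ∧ distinctL xs

Distinct : ∀ {m k} → Vec (Fin m) k → Bool
Distinct v = distinctL (toList v)

tuples : (m k : ℕ) → List (Vec (Fin m) k)
tuples m k = filter (λ v → T? (Distinct v)) (allVecs m k)
  where
  open import Data.Bool.Properties using () renaming (T? to T?)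

inΩ : ∀ {n k} → Vec (Fin n) k → Vec (Fin k) k → State n k → Bool
inΩ {n} {k} u γ S = all (λ i → eqFin (lookup S (lookup u i)) (lookup γ i)) (allFin k)

-- D ∈ 𝒟(G, τ)   (does not depend on the edges of G, only on V)
InCalD : ∀ {n k} → (State n k → ℚ) → Set
InCalD {n} {k} D =
  Σ (Vec (Fin n) k → Vec (Fin k) k → State n k → ℚ) λ Dug →
    (∀ u γ → T (Distinct u) → T (Distinct γ) →
        IsDistribution (Dug u γ) ×
        (∀ S → inΩ u γ S ≡ false → Dug u γ S ≡ 0ℚ)) ×
    (∀ S → D S ≡
        (Σ[ tuples n k ] λ u → Σ[ tuples k k ] λ γ → Dug u γ S)
          ÷₀ ℕ→ℚ (length (tuples n k) ℕ.* length (tuples k k)))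

totalFitness : ∀ {n k} → (Fin k → ℚ) → State n k → ℚ
totalFitness {n} f S = Σ[ allFin n ] λ u → f (lookup S u)

trans : ∀ {n k} → Graph n → (Fin k → ℚ) → State n k → State n k → ℚ
trans {n} G f S S' =
  Σ[ allFin n ] λ v →
    Σ[ nbrs G v ] λ w →
      [ eqState (update S v w) S' ] *
      ((f (lookup S v) ÷₀ totalFitness f S) * (1ℚ ÷₀ ℕ→ℚ (deg G v)))

countType : ∀ {n k} → Fin k → State n k → ℕ
countType j S = length (filter (λ i → i Fin.≟ j) (toList S))

absorbed : ∀ {n k} → Fin k → State n k → Bool
absorbed {n} j S = (countType j S ℕ.≡ᵇ 0) ∨ (countType j S ℕ.≡ᵇ n)

-- r t S = Pr(M_t = S and M_0, …, M_{t-1} are not absorbed for type j)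
notAbsorbedMass : ∀ {n k} → Graph n → (Fin k → ℚ) → (State n k → ℚ) →
                  Fin k → ℕ → State n k → ℚ
notAbsorbedMass G f D j zero S = D S
notAbsorbedMass {n} {k} G f D j (suc t) S' =
  Σ[ allVecs k n ] λ S →
    [ not (absorbed j S) ] * (notAbsorbedMass G f D j t S * trans G f S S')

PrA≡ : ∀ {n k} → Graph n → (Fin k → ℚ) → (State n k → ℚ) → Fin k → ℕ → ℚ
PrA≡ {n} {k} G f D j t =
  Σ[ allVecs k n ] λ S → [ absorbed j S ] * notAbsorbedMass G f D j t S

partialExp : ∀ {n k} → Graph n → (Fin k → ℚ) → (State n k → ℚ) → Fin k → ℕ → ℚ
partialExp G f D j zero = 0ℚ
partialExp G f D j (suc T) = partialExp G f D j T + ℕ→ℚ T * PrA≡ G f D j T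

-- E(A_j) ≤ B  (the expectation of a ℕ-valued random variable is the sum
-- of the nonnegative series Σ_t t·Pr(A=t); it is ≤ B iff all partial sums are)
ExpA≤ : ∀ {n k} → Graph n → (Fin k → ℚ) → (State n k → ℚ) → Fin k → ℚ → Set
ExpA≤ G f D j B = ∀ T → partialExp G f D j T ≤ B

fmax : ∀ {k} → (Fin k → ℚ) → ℚ
fmax {k} f = maxOver (allFin k) f

InTauMax : ∀ {k} → (Fin k → ℚ) → Fin k → Set
InTauMax f j = f j ≡ fmax f

tauMaxList : ∀ {k} → (Fin k → ℚ) → List (Fin k)
tauMaxList {k} f = filter (λ j → f j ≟ fmax f) (allFin k)

fstar : ∀ {k} → (Fin k → ℚ) → ℚ
fstar {k} f = maxOver (filter (λ j → Relation.Nullary.¬? (f j ≟ fmax f)) (allFin k)) f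
  where import Relation.Nullary

{-# OPTIONS --safe #-}
module Submission where

-- Let φ(S) = Σ { 1/deg(u) : S(u) = α }.  A move v → w changes φ by Δ = (χ(v) − χ(w))/deg(w),
-- where χ indicates type α.  Pairing each move with its reverse writes 2E[Δ] as a sum over
-- edges of (χ(v) − χ(w))(f(S v) − f(S w))/(W deg(v) deg(w)), which is ≥ 0 because f(α) is
-- maximal.  While α is neither extinct nor fixed, connectivity gives an edge from type α to
-- another type.  If α is the only fittest type, that edge contributes at least
-- (f(α) − f*)/(f(α) n³) to E[Δ], so n − φ drifts down by that amount; otherwise n² − φ² still
-- drifts down by E[Δ²] ≥ 1/n⁴.  A potential in [0, G₀] drifting down by δ before absorption
-- gives E(A) ≤ G₀/δ, that is f(α)/(f(α) − f*) · n⁴ and n⁶ respectively.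

module Absorption where

  open import Defs
  open import Data.Nat as ℕ using (ℕ; zero; suc; z≤n; s≤s; _^_; _∸_)
  import Data.Nat.Properties as ℕP
  import Data.Integer as ℤ
  import Data.Integer.Properties as ℤP
  open import Data.Rational as ℚ using (ℚ; 0ℚ; 1ℚ; _+_; _*_; _-_; -_; _≤_; _<_; _⊔_; 1/_; toℚᵘ)
  open import Data.Rational.Properties
  import Data.Rational.Unnormalised as ℚᵘ
  import Data.Rational.Unnormalised.Properties as ℚᵘP
  open import Data.Rational.Solver using (module +-*-Solver)
  open +-*-Solver using (solve; _:=_; _:+_; _:*_; _:-_; :-_; con)
  open import Data.Bool using (true; false; not; _∧_; _∨_; T)
  import Data.Bool.Properties as BoolP
  open import Data.Fin as Fin using (Fin)
  open import Data.Vec as Vec using (lookup)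
  import Data.Vec.Properties as VecP
  open import Data.Fin.Properties using (any?)
  open import Data.List as List using (List; []; _∷_; map; concatMap; allFin; filter; _++_; length)
  import Data.List.Properties as ListP
  open import Data.List.Relation.Unary.Any using (here; there)
  open import Data.List.Membership.Propositional using (_∈_)
  open import Data.List.Membership.Propositional.Properties using (∈-filter⁺; ∈-filter⁻; ∈-allFin; ∈-map⁻; ∈-length; foldr-selective)
  open import Data.Product using (∃; ∃₂; _×_; _,_; proj₁; proj₂)
  open import Data.Sum using (_⊎_; inj₁; inj₂)
  open import Data.Empty using (⊥-elim)
  open import Function using (_∘_; Equivalence)
  open import Relation.Nullary using (Dec; yes; no; ¬_; ¬?; does)
  open import Relation.Nullary.Decidable using (_×-dec_; toWitness; isYes≗does; dec-true; dec-false)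
  open import Relation.Unary using (Pred; Decidable)
  open import Relation.Binary.Definitions using (tri<; tri≈; tri>)
  open import Relation.Binary.PropositionalEquality
    using (_≡_; _≢_; refl; sym; cong; cong₂; subst; subst₂; module ≡-Reasoning)
    renaming (trans to ≡-trans)
  open import Relation.Binary.Construct.Closure.ReflexiveTransitive using (Star; ε; _◅_)

  0≤1 : 0ℚ ≤ 1ℚ
  0≤1 = ℚ.*≤* (ℤ.+≤+ z≤n)

  0<1 : 0ℚ < 1ℚ
  0<1 = ℚ.*<* (ℤ.+<+ (s≤s z≤n))

  p≤q⇒0≤q-p : ∀ {p q} → p ≤ q → 0ℚ ≤ q - p
  p≤q⇒0≤q-p {p} {q} p≤q = subst (_≤ q - p) (+-inverseʳ p) (+-monoˡ-≤ (- p) p≤q)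

  0≤q-p⇒p≤q : ∀ {p q} → 0ℚ ≤ q - p → p ≤ q
  0≤q-p⇒p≤q {p} {q} 0≤q-p =
    subst₂ _≤_ (+-identityˡ p) (solve 2 (λ p q → q :- p :+ p := q) refl p q) (+-monoˡ-≤ p 0≤q-p)

  q-p≤q : ∀ {p} q → 0ℚ ≤ p → q - p ≤ q
  q-p≤q {p} q 0≤p = 0≤q-p⇒p≤q (subst (0ℚ ≤_) (solve 2 (λ p q → p := q :- (q :- p)) refl p q) 0≤p)

  ≤∧≢⇒< : ∀ {p q} → p ≤ q → p ≢ q → p < q
  ≤∧≢⇒< {p} {q} p≤q p≢q with <-cmp p q
  ... | tri< p<q _ _ = p<q
  ... | tri≈ _ p≡q _ = ⊥-elim (p≢q p≡q)
  ... | tri> _ _ q<p = ⊥-elim (<-irrefl refl (<-≤-trans q<p p≤q))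

  p≤q+p : ∀ {p q} → 0ℚ ≤ q → p ≤ q + p
  p≤q+p {p} {q} 0≤q = subst (_≤ q + p) (+-identityˡ p) (+-monoˡ-≤ p 0≤q)

  p≤p+q : ∀ {p q} → 0ℚ ≤ q → p ≤ p + q
  p≤p+q {p} {q} 0≤q = subst (_≤ p + q) (+-identityʳ p) (+-monoʳ-≤ p 0≤q)

  pos⇒≢0 : ∀ {p} → 0ℚ < p → p ≢ 0ℚ
  pos⇒≢0 0<p p≡0 = <-irrefl (sym p≡0) 0<p

  *-nonNeg : ∀ {p q} → 0ℚ ≤ p → 0ℚ ≤ q → 0ℚ ≤ p * q
  *-nonNeg {p} {q} 0≤p 0≤q =
    nonNegative⁻¹ _ {{nonNeg*nonNeg⇒nonNeg p {{ℚ.nonNegative 0≤p}} q {{ℚ.nonNegative 0≤q}}}}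

  *-pos : ∀ {p q} → 0ℚ < p → 0ℚ < q → 0ℚ < p * q
  *-pos {p} {q} 0<p 0<q = positive⁻¹ _ {{pos*pos⇒pos p {{ℚ.positive 0<p}} q {{ℚ.positive 0<q}}}}

  0≤p*p : ∀ p → 0ℚ ≤ p * p
  0≤p*p p with ≤-total 0ℚ p
  ... | inj₁ 0≤p = *-nonNeg 0≤p 0≤p
  ... | inj₂ p≤0 = subst (0ℚ ≤_) (solve 1 (λ p → (:- p) :* (:- p) := p :* p) refl p)
                     (*-nonNeg (neg-antimono-≤ p≤0) (neg-antimono-≤ p≤0))

  *-monoˡ-≤-0≤ : ∀ {r p q} → 0ℚ ≤ r → p ≤ q → r * p ≤ r * q
  *-monoˡ-≤-0≤ {r} 0≤r = *-monoˡ-≤-nonNeg r {{ℚ.nonNegative 0≤r}}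

  *-monoʳ-≤-0≤ : ∀ {r p q} → 0ℚ ≤ r → p ≤ q → p * r ≤ q * r
  *-monoʳ-≤-0≤ {r} 0≤r = *-monoʳ-≤-nonNeg r {{ℚ.nonNegative 0≤r}}

  *-mono-≤-0≤ : ∀ {p q r s} → 0ℚ ≤ p → p ≤ q → 0ℚ ≤ r → r ≤ s → p * r ≤ q * s
  *-mono-≤-0≤ 0≤p p≤q 0≤r r≤s = ≤-trans (*-monoʳ-≤-0≤ 0≤r p≤q) (*-monoˡ-≤-0≤ (≤-trans 0≤p p≤q) r≤s)

  *-cancelˡ-≤-0< : ∀ {r p q} → 0ℚ < r → r * p ≤ r * q → p ≤ q
  *-cancelˡ-≤-0< {r} 0<r = *-cancelˡ-≤-pos r {{ℚ.positive 0<r}}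

  p+p≤q+q⇒p≤q : ∀ {p q} → p + p ≤ q + q → p ≤ q
  p+p≤q+q⇒p≤q {p} {q} = *-cancelˡ-≤-0< (+-mono-< 0<1 0<1) ∘ subst₂ _≤_ (double p) (double q)
    where
    double : ∀ p → p + p ≡ (1ℚ + 1ℚ) * p
    double = solve 1 (λ p → p :+ p := (con 1ℚ :+ con 1ℚ) :* p) refl

  ℕ→ℚᵘ : ℕ → ℚᵘ.ℚᵘ
  ℕ→ℚᵘ m = ℚᵘ.mkℚᵘ (ℤ.+ m) 0

  toℚᵘ-ℕ→ℚ : ∀ m → toℚᵘ (ℕ→ℚ m) ℚᵘ.≃ ℕ→ℚᵘ m
  toℚᵘ-ℕ→ℚ m = toℚᵘ-fromℚᵘ (ℕ→ℚᵘ m)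

  ℕ→ℚ-+ : ∀ m n → ℕ→ℚ (m ℕ.+ n) ≡ ℕ→ℚ m + ℕ→ℚ n
  ℕ→ℚ-+ m n = toℚᵘ-injective (begin
    toℚᵘ (ℕ→ℚ (m ℕ.+ n))            ≈⟨ toℚᵘ-fromℚᵘ (ℕ→ℚᵘ (m ℕ.+ n)) ⟩
    ℕ→ℚᵘ (m ℕ.+ n)                  ≈⟨ ℚᵘ.*≡* (cong (ℤ._* ℤ.+ 1) numerators) ⟩
    ℕ→ℚᵘ m ℚᵘ.+ ℕ→ℚᵘ n              ≈⟨ ℚᵘP.+-cong (toℚᵘ-ℕ→ℚ m) (toℚᵘ-ℕ→ℚ n) ⟨
    toℚᵘ (ℕ→ℚ m) ℚᵘ.+ toℚᵘ (ℕ→ℚ n)  ≈⟨ toℚᵘ-homo-+ (ℕ→ℚ m) (ℕ→ℚ n) ⟨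
    toℚᵘ (ℕ→ℚ m + ℕ→ℚ n)            ∎)
    where
    open ℚᵘP.≃-Reasoning
    numerators : ℤ.+ (m ℕ.+ n) ≡ ℤ.+ m ℤ.* ℤ.+ 1 ℤ.+ ℤ.+ n ℤ.* ℤ.+ 1
    numerators = ≡-trans (ℤP.pos-+ m n) (sym (cong₂ ℤ._+_ (ℤP.*-identityʳ (ℤ.+ m)) (ℤP.*-identityʳ (ℤ.+ n))))

  ℕ→ℚ-* : ∀ m n → ℕ→ℚ (m ℕ.* n) ≡ ℕ→ℚ m * ℕ→ℚ n
  ℕ→ℚ-* m n = toℚᵘ-injective (begin
    toℚᵘ (ℕ→ℚ (m ℕ.* n))            ≈⟨ toℚᵘ-fromℚᵘ (ℕ→ℚᵘ (m ℕ.* n)) ⟩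
    ℕ→ℚᵘ (m ℕ.* n)                  ≈⟨ ℚᵘ.*≡* (cong (ℤ._* ℤ.+ 1) (ℤP.pos-* m n)) ⟩
    ℕ→ℚᵘ m ℚᵘ.* ℕ→ℚᵘ n              ≈⟨ ℚᵘP.*-cong (toℚᵘ-ℕ→ℚ m) (toℚᵘ-ℕ→ℚ n) ⟨
    toℚᵘ (ℕ→ℚ m) ℚᵘ.* toℚᵘ (ℕ→ℚ n)  ≈⟨ toℚᵘ-homo-* (ℕ→ℚ m) (ℕ→ℚ n) ⟨
    toℚᵘ (ℕ→ℚ m * ℕ→ℚ n)            ∎)
    where open ℚᵘP.≃-Reasoning

  ℕ→ℚ-nonNeg : ∀ m → 0ℚ ≤ ℕ→ℚ m
  ℕ→ℚ-nonNeg m = nonNegative⁻¹ (ℕ→ℚ m) {{normalize-nonNeg m 1}}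

  ℕ→ℚ-mono-≤ : ∀ {m n} → m ℕ.≤ n → ℕ→ℚ m ≤ ℕ→ℚ n
  ℕ→ℚ-mono-≤ {m} m≤n with ℕP.m≤n⇒∃[o]m+o≡n m≤n
  ... | o , refl = subst (_≤ ℕ→ℚ (m ℕ.+ o)) (+-identityʳ (ℕ→ℚ m))
                     (≤-trans (+-monoʳ-≤ (ℕ→ℚ m) (ℕ→ℚ-nonNeg o)) (≤-reflexive (sym (ℕ→ℚ-+ m o))))

  ℕ→ℚ-pos : ∀ {m} → 1 ℕ.≤ m → 0ℚ < ℕ→ℚ m
  ℕ→ℚ-pos 1≤m = <-≤-trans 0<1 (ℕ→ℚ-mono-≤ 1≤m)

  inv : ℚ → ℚ
  inv q with q ≟ 0ℚ
  ... | yes _ = 0ℚ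
  ... | no q≢0 = (1/ q) {{ℚ.≢-nonZero q≢0}}

  ÷₀≡*inv : ∀ p q → p ÷₀ q ≡ p * inv q
  ÷₀≡*inv p q with q ≟ 0ℚ
  ... | yes _ = sym (*-zeroʳ p)
  ... | no _ = refl

  *-inv : ∀ {q} → q ≢ 0ℚ → q * inv q ≡ 1ℚ
  *-inv {q} q≢0 with q ≟ 0ℚ
  ... | yes q≡0 = ⊥-elim (q≢0 q≡0)
  ... | no q≢0 = *-inverseʳ q {{ℚ.≢-nonZero q≢0}}

  inv-0 : ∀ {q} → q ≡ 0ℚ → inv q ≡ 0ℚ
  inv-0 refl = refl

  p*inv[p]≤1 : ∀ p → p * inv p ≤ 1ℚ
  p*inv[p]≤1 p with p ≟ 0ℚ
  ... | yes refl = 0≤1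
  ... | no p≢0 = ≤-reflexive (*-inverseʳ p {{ℚ.≢-nonZero p≢0}})

  inv-pos : ∀ {q} → 0ℚ < q → 0ℚ < inv q
  inv-pos {q} 0<q with q ≟ 0ℚ
  ... | yes q≡0 = ⊥-elim (pos⇒≢0 0<q q≡0)
  ... | no q≢0 = positive⁻¹ _ {{1/pos⇒pos q {{ℚ.positive 0<q}}}}

  inv-nonNeg : ∀ {q} → 0ℚ ≤ q → 0ℚ ≤ inv q
  inv-nonNeg {q} 0≤q with q ≟ 0ℚ
  ... | yes _ = ≤-refl
  ... | no q≢0 = <⇒≤ (positive⁻¹ _ {{1/pos⇒pos q {{ℚ.positive (≤∧≢⇒< 0≤q (q≢0 ∘ sym))}}}})

  *-≢0 : ∀ {p q} → p ≢ 0ℚ → q ≢ 0ℚ → p * q ≢ 0ℚ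
  *-≢0 {p} {q} p≢0 q≢0 pq≡0 = p≢0 (begin
    p                  ≡⟨ *-identityʳ p ⟨
    p * 1ℚ             ≡⟨ cong (p *_) (*-inv q≢0) ⟨
    p * (q * inv q)    ≡⟨ *-assoc p q (inv q) ⟨
    p * q * inv q      ≡⟨ cong (_* inv q) pq≡0 ⟩
    0ℚ * inv q         ≡⟨ *-zeroˡ (inv q) ⟩
    0ℚ                 ∎)
    where open ≡-Reasoning

  inv-* : ∀ p q → inv (p * q) ≡ inv p * inv q
  inv-* p q = by-cases (p ≟ 0ℚ) (q ≟ 0ℚ)
    where
    open ≡-Reasoning
    by-cases : Dec (p ≡ 0ℚ) → Dec (q ≡ 0ℚ) → inv (p * q) ≡ inv p * inv q
    by-cases (yes p≡0) _ = begin
      inv (p * q)     ≡⟨ inv-0 (≡-trans (cong (_* q) p≡0) (*-zeroˡ q)) ⟩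
      0ℚ              ≡⟨ *-zeroˡ (inv q) ⟨
      0ℚ * inv q      ≡⟨ cong (_* inv q) (inv-0 p≡0) ⟨
      inv p * inv q   ∎
    by-cases (no _) (yes q≡0) = begin
      inv (p * q)     ≡⟨ inv-0 (≡-trans (cong (p *_) q≡0) (*-zeroʳ p)) ⟩
      0ℚ              ≡⟨ *-zeroʳ (inv p) ⟨
      inv p * 0ℚ      ≡⟨ cong (inv p *_) (inv-0 q≡0) ⟨
      inv p * inv q   ∎
    by-cases (no p≢0) (no q≢0) = begin
      inv (p * q)                                  ≡⟨ *-identityʳ (inv (p * q)) ⟨
      inv (p * q) * 1ℚ                             ≡⟨ cong (λ x → inv (p * q) * x) (cong₂ _*_ (*-inv p≢0) (*-inv q≢0)) ⟨
      inv (p * q) * ((p * inv p) * (q * inv q))    ≡⟨ solve 5 (λ x p q a b → x :* ((p :* a) :* (q :* b)) := ((p :* q) :* x) :* (a :* b)) refl (inv (p * q)) p q (inv p) (inv q) ⟩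
      ((p * q) * inv (p * q)) * (inv p * inv q)    ≡⟨ cong (_* (inv p * inv q)) (*-inv (*-≢0 p≢0 q≢0)) ⟩
      1ℚ * (inv p * inv q)                         ≡⟨ *-identityˡ (inv p * inv q) ⟩
      inv p * inv q                                ∎

  inv-antimono-≤ : ∀ {p q} → 0ℚ < p → p ≤ q → inv q ≤ inv p
  inv-antimono-≤ {p} {q} 0<p p≤q = begin
    inv q                      ≡⟨ *-identityʳ (inv q) ⟨
    inv q * 1ℚ                 ≡⟨ cong (inv q *_) (*-inv (pos⇒≢0 0<p)) ⟨
    inv q * (p * inv p)        ≤⟨ *-monoˡ-≤-0≤ (inv-nonNeg 0≤q) (*-monoʳ-≤-0≤ (inv-nonNeg (<⇒≤ 0<p)) p≤q) ⟩
    inv q * (q * inv p)        ≡⟨ solve 3 (λ a q b → a :* (q :* b) := (q :* a) :* b) refl (inv q) q (inv p) ⟩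
    (q * inv q) * inv p        ≡⟨ cong (_* inv p) (*-inv (pos⇒≢0 (<-≤-trans 0<p p≤q))) ⟩
    1ℚ * inv p                 ≡⟨ *-identityˡ (inv p) ⟩
    inv p                      ∎
    where
    open ≤-Reasoning
    0≤q : 0ℚ ≤ q
    0≤q = ≤-trans (<⇒≤ 0<p) p≤q

  module _ {A : Set} where

    Σ-cong : ∀ (xs : List A) {g h : A → ℚ} → (∀ x → g x ≡ h x) → Σ[ xs ] g ≡ Σ[ xs ] h
    Σ-cong []       g≡h = refl
    Σ-cong (x ∷ xs) g≡h = cong₂ _+_ (g≡h x) (Σ-cong xs g≡h)

    Σ-0 : ∀ (xs : List A) → Σ[ xs ] (λ _ → 0ℚ) ≡ 0ℚ
    Σ-0 []       = refl
    Σ-0 (x ∷ xs) = cong (0ℚ +_) (Σ-0 xs)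

    Σ-+ : ∀ (xs : List A) (g h : A → ℚ) → Σ[ xs ] (λ x → g x + h x) ≡ Σ[ xs ] g + Σ[ xs ] h
    Σ-+ []       g h = refl
    Σ-+ (x ∷ xs) g h = ≡-trans (cong (g x + h x +_) (Σ-+ xs g h))
      (solve 4 (λ a b c d → a :+ b :+ (c :+ d) := a :+ c :+ (b :+ d)) refl
        (g x) (h x) (Σ[ xs ] g) (Σ[ xs ] h))

    Σ-*ˡ : ∀ (xs : List A) (c : ℚ) (g : A → ℚ) → Σ[ xs ] (λ x → c * g x) ≡ c * Σ[ xs ] g
    Σ-*ˡ []       c g = sym (*-zeroʳ c)
    Σ-*ˡ (x ∷ xs) c g = ≡-trans (cong (c * g x +_) (Σ-*ˡ xs c g)) (sym (*-distribˡ-+ c (g x) _))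

    Σ-*ʳ : ∀ (xs : List A) (c : ℚ) (g : A → ℚ) → Σ[ xs ] (λ x → g x * c) ≡ Σ[ xs ] g * c
    Σ-*ʳ xs c g = ≡-trans (Σ-cong xs (λ x → *-comm (g x) c)) (≡-trans (Σ-*ˡ xs c g) (*-comm c _))

    Σ-sub : ∀ (xs : List A) (g h : A → ℚ) → Σ[ xs ] (λ x → g x - h x) ≡ Σ[ xs ] g - Σ[ xs ] h
    Σ-sub xs g h = begin
      Σ[ xs ] (λ x → g x - h x)               ≡⟨ Σ-cong xs (λ x → cong (g x +_) (neg-is-scaling (h x))) ⟩
      Σ[ xs ] (λ x → g x + - 1ℚ * h x)        ≡⟨ Σ-+ xs g (λ x → - 1ℚ * h x) ⟩
      Σ[ xs ] g + Σ[ xs ] (λ x → - 1ℚ * h x)  ≡⟨ cong (Σ[ xs ] g +_) (Σ-*ˡ xs (- 1ℚ) h) ⟩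
      Σ[ xs ] g + - 1ℚ * Σ[ xs ] h            ≡⟨ cong (Σ[ xs ] g +_) (neg-is-scaling (Σ[ xs ] h)) ⟨
      Σ[ xs ] g - Σ[ xs ] h                   ∎
      where
      open ≡-Reasoning
      neg-is-scaling : ∀ p → - p ≡ - 1ℚ * p
      neg-is-scaling = solve 1 (λ p → :- p := con (- 1ℚ) :* p) refl

    Σ-mono-≤ : ∀ (xs : List A) {g h : A → ℚ} → (∀ x → g x ≤ h x) → Σ[ xs ] g ≤ Σ[ xs ] h
    Σ-mono-≤ []       g≤h = ≤-refl
    Σ-mono-≤ (x ∷ xs) g≤h = +-mono-≤ (g≤h x) (Σ-mono-≤ xs g≤h)

    Σ-nonNeg : ∀ (xs : List A) {g : A → ℚ} → (∀ x → 0ℚ ≤ g x) → 0ℚ ≤ Σ[ xs ] g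
    Σ-nonNeg xs {g} 0≤g = subst (_≤ Σ[ xs ] g) (Σ-0 xs) (Σ-mono-≤ xs 0≤g)

    Σ-const : ∀ (xs : List A) (c : ℚ) → Σ[ xs ] (λ _ → c) ≡ ℕ→ℚ (length xs) * c
    Σ-const []       c = sym (*-zeroˡ c)
    Σ-const (x ∷ xs) c = begin
      c + Σ[ xs ] (λ _ → c)           ≡⟨ cong (c +_) (Σ-const xs c) ⟩
      c + ℕ→ℚ (length xs) * c         ≡⟨ solve 2 (λ m c → c :+ m :* c := (con 1ℚ :+ m) :* c) refl (ℕ→ℚ (length xs)) c ⟩
      (1ℚ + ℕ→ℚ (length xs)) * c      ≡⟨ cong (_* c) (ℕ→ℚ-+ 1 (length xs)) ⟨
      ℕ→ℚ (suc (length xs)) * c       ∎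
      where open ≡-Reasoning

    Σ-filter : ∀ {ℓ} {P : Pred A ℓ} (P? : Decidable P) (xs : List A) (g : A → ℚ) →
               Σ[ filter P? xs ] g ≡ Σ[ xs ] (λ x → [ does (P? x) ] * g x)
    Σ-filter P? []       g = refl
    Σ-filter P? (x ∷ xs) g with does (P? x)
    ... | true  = cong₂ _+_ (sym (*-identityˡ (g x))) (Σ-filter P? xs g)
    ... | false = ≡-trans (Σ-filter P? xs g)
                    (≡-trans (sym (+-identityˡ _)) (cong (_+ _) (sym (*-zeroˡ (g x)))))

    ∈⇒≤Σ : ∀ (xs : List A) {g : A → ℚ} → (∀ x → 0ℚ ≤ g x) → ∀ {y} → y ∈ xs → g y ≤ Σ[ xs ] g
    ∈⇒≤Σ (x ∷ xs) 0≤g (here refl)  = p≤p+q (Σ-nonNeg xs 0≤g)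
    ∈⇒≤Σ (x ∷ xs) 0≤g (there y∈xs) = ≤-trans (∈⇒≤Σ xs 0≤g y∈xs) (p≤q+p (0≤g x))

    ∈∧∈⇒≤Σ : ∀ (xs : List A) {g : A → ℚ} → (∀ x → 0ℚ ≤ g x) →
             ∀ {y z} → y ∈ xs → z ∈ xs → y ≢ z → g y + g z ≤ Σ[ xs ] g
    ∈∧∈⇒≤Σ (x ∷ xs) 0≤g (here refl) (here refl) y≢z = ⊥-elim (y≢z refl)
    ∈∧∈⇒≤Σ (x ∷ xs) {g} 0≤g (here refl) (there z∈xs) _ = +-monoʳ-≤ (g x) (∈⇒≤Σ xs 0≤g z∈xs)
    ∈∧∈⇒≤Σ (x ∷ xs) {g} 0≤g {y} (there y∈xs) (here refl) _ =
      subst (_≤ g x + Σ[ xs ] g) (+-comm (g x) (g y)) (+-monoʳ-≤ (g x) (∈⇒≤Σ xs 0≤g y∈xs))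
    ∈∧∈⇒≤Σ (x ∷ xs) 0≤g (there y∈xs) (there z∈xs) y≢z =
      ≤-trans (∈∧∈⇒≤Σ xs 0≤g y∈xs z∈xs y≢z) (p≤q+p (0≤g x))

    Σ-++ : ∀ (xs ys : List A) (g : A → ℚ) → Σ[ xs ++ ys ] g ≡ Σ[ xs ] g + Σ[ ys ] g
    Σ-++ []       ys g = sym (+-identityˡ _)
    Σ-++ (x ∷ xs) ys g = ≡-trans (cong (g x +_) (Σ-++ xs ys g)) (sym (+-assoc (g x) _ _))

  module _ {A B : Set} where

    Σ-map : ∀ (h : A → B) (xs : List A) (g : B → ℚ) → Σ[ map h xs ] g ≡ Σ[ xs ] (g ∘ h)
    Σ-map h []       g = refl
    Σ-map h (x ∷ xs) g = cong (g (h x) +_) (Σ-map h xs g)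

    Σ-concatMap : ∀ (h : A → List B) (xs : List A) (g : B → ℚ) →
                  Σ[ concatMap h xs ] g ≡ Σ[ xs ] (λ x → Σ[ h x ] g)
    Σ-concatMap h []       g = refl
    Σ-concatMap h (x ∷ xs) g =
      ≡-trans (Σ-++ (h x) (concatMap h xs) g) (cong (Σ[ h x ] g +_) (Σ-concatMap h xs g))

    Σ-comm : ∀ (xs : List A) (ys : List B) (F : A → B → ℚ) →
             Σ[ xs ] (λ x → Σ[ ys ] (F x)) ≡ Σ[ ys ] (λ y → Σ[ xs ] (λ x → F x y))
    Σ-comm []       ys F = sym (Σ-0 ys)
    Σ-comm (x ∷ xs) ys F = ≡-trans (cong (Σ[ ys ] (F x) +_) (Σ-comm xs ys F))
      (sym (Σ-+ ys (F x) (λ y → Σ[ xs ] (λ x′ → F x′ y))))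

  []-nonNeg : ∀ b → 0ℚ ≤ [ b ]
  []-nonNeg true  = 0≤1
  []-nonNeg false = ≤-refl

  []-≤1 : ∀ b → [ b ] ≤ 1ℚ
  []-≤1 true  = ≤-refl
  []-≤1 false = 0≤1

  []*-≤ : ∀ b {p} → 0ℚ ≤ p → [ b ] * p ≤ p
  []*-≤ b {p} 0≤p = subst ([ b ] * p ≤_) (*-identityˡ p) (*-monoʳ-≤-0≤ 0≤p ([]-≤1 b))

  indicator-guarded : ∀ b {p q r} → 0ℚ ≤ p → (b ≡ false → q ≤ r) → [ not b ] * p * q ≤ [ not b ] * p * r
  indicator-guarded true  {p} {q} {r} _ _ = ≤-reflexive (≡-trans (cong (_* q) (*-zeroˡ p))
    (≡-trans (*-zeroˡ q) (sym (≡-trans (cong (_* r) (*-zeroˡ p)) (*-zeroˡ r)))))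
  indicator-guarded false 0≤p q≤r = *-monoˡ-≤-0≤ (*-nonNeg 0≤1 0≤p) (q≤r refl)

  indicator-aligned : ∀ a b {x y} → (a ≡ true → y ≤ x) → (b ≡ true → x ≤ y) → 0ℚ ≤ ([ a ] - [ b ]) * (x - y)
  indicator-aligned true  true  {x} {y} _ _ = ≤-reflexive (sym (*-zeroˡ (x - y)))
  indicator-aligned true  false {x} {y} y≤x _ = subst (0ℚ ≤_) (sym (*-identityˡ (x - y))) (p≤q⇒0≤q-p (y≤x refl))
  indicator-aligned false true  {x} {y} _ x≤y = subst (0ℚ ≤_) (solve 2 (λ x y → y :- x := (con 0ℚ :- con 1ℚ) :* (x :- y)) refl x y) (p≤q⇒0≤q-p (x≤y refl))
  indicator-aligned false false {x} {y} _ _ = ≤-reflexive (sym (*-zeroˡ (x - y)))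

  []-∧ : ∀ a b → [ a ∧ b ] ≡ [ a ] * [ b ]
  []-∧ true  b = sym (*-identityˡ [ b ])
  []-∧ false b = sym (*-zeroˡ [ b ])

  [b]+[not-b]≡1 : ∀ b → [ b ] + [ not b ] ≡ 1ℚ
  [b]+[not-b]≡1 true  = refl
  [b]+[not-b]≡1 false = refl

  eqFin-suc : ∀ {k} (x y : Fin k) → eqFin (Fin.suc x) (Fin.suc y) ≡ eqFin x y
  eqFin-suc x y with x Fin.≟ y
  ... | yes _ = refl
  ... | no _  = refl

  eqState-∷ : ∀ {n k} (x y : Fin k) (xs ys : State n k) →
              eqState (x Vec.∷ xs) (y Vec.∷ ys) ≡ eqFin x y ∧ eqState xs ys
  eqState-∷ x y xs ys with x Fin.≟ y | VecP.≡-dec Fin._≟_ xs ys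
  ... | yes _ | yes _ = refl
  ... | yes _ | no _  = refl
  ... | no _  | yes _ = refl
  ... | no _  | no _  = refl

  Σ-allFin-suc : ∀ k (g : Fin (suc k) → ℚ) →
                 Σ[ allFin (suc k) ] g ≡ g Fin.zero + Σ[ allFin k ] (g ∘ Fin.suc)
  Σ-allFin-suc k g = cong (g Fin.zero +_)
    (≡-trans (cong (λ xs → Σ[ xs ] g) (sym (ListP.map-tabulate (λ i → i) Fin.suc)))
             (Σ-map Fin.suc (allFin k) g))

  Σ-allFin-eqFin : ∀ k (x : Fin k) (c : Fin k → ℚ) → Σ[ allFin k ] (λ y → [ eqFin x y ] * c y) ≡ c x
  Σ-allFin-eqFin (suc k) Fin.zero c = begin
    Σ[ allFin (suc k) ] (λ y → [ eqFin Fin.zero y ] * c y)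
      ≡⟨ Σ-allFin-suc k (λ y → [ eqFin Fin.zero y ] * c y) ⟩
    1ℚ * c Fin.zero + Σ[ allFin k ] (λ y → 0ℚ * c (Fin.suc y))
      ≡⟨ cong₂ _+_ (*-identityˡ (c Fin.zero)) (≡-trans (Σ-cong (allFin k) (λ y → *-zeroˡ (c (Fin.suc y)))) (Σ-0 (allFin k))) ⟩
    c Fin.zero + 0ℚ
      ≡⟨ +-identityʳ (c Fin.zero) ⟩
    c Fin.zero ∎
    where open ≡-Reasoning
  Σ-allFin-eqFin (suc k) (Fin.suc x) c = begin
    Σ[ allFin (suc k) ] (λ y → [ eqFin (Fin.suc x) y ] * c y)
      ≡⟨ Σ-allFin-suc k (λ y → [ eqFin (Fin.suc x) y ] * c y) ⟩
    0ℚ * c Fin.zero + Σ[ allFin k ] (λ y → [ eqFin (Fin.suc x) (Fin.suc y) ] * c (Fin.suc y))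
      ≡⟨ cong₂ _+_ (*-zeroˡ (c Fin.zero)) (Σ-cong (allFin k) (λ y → cong (λ b → [ b ] * c (Fin.suc y)) (eqFin-suc x y))) ⟩
    0ℚ + Σ[ allFin k ] (λ y → [ eqFin x y ] * c (Fin.suc y))
      ≡⟨ +-identityˡ _ ⟩
    Σ[ allFin k ] (λ y → [ eqFin x y ] * c (Fin.suc y))
      ≡⟨ Σ-allFin-eqFin k x (c ∘ Fin.suc) ⟩
    c (Fin.suc x) ∎
    where open ≡-Reasoning

  Σ-allVecs-eqState : ∀ k n (X : State n k) (c : State n k → ℚ) →
                    Σ[ allVecs k n ] (λ S → [ eqState X S ] * c S) ≡ c X
  Σ-allVecs-eqState k zero    Vec.[]         c = ≡-trans (+-identityʳ _) (*-identityˡ _)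
  Σ-allVecs-eqState k (suc n) (x Vec.∷ xs) c = begin
    Σ[ allVecs k (suc n) ] (λ S → [ eqState (x Vec.∷ xs) S ] * c S)
      ≡⟨ Σ-concatMap (λ y → map (y Vec.∷_) (allVecs k n)) (allFin k) _ ⟩
    Σ[ allFin k ] (λ y → Σ[ map (y Vec.∷_) (allVecs k n) ] (λ S → [ eqState (x Vec.∷ xs) S ] * c S))
      ≡⟨ Σ-cong (allFin k) (λ y → ≡-trans (Σ-map (y Vec.∷_) (allVecs k n) _)
           (Σ-cong (allVecs k n) (split-indicator y))) ⟩
    Σ[ allFin k ] (λ y → Σ[ allVecs k n ] (λ ys → [ eqFin x y ] * ([ eqState xs ys ] * c (y Vec.∷ ys))))
      ≡⟨ Σ-cong (allFin k) (λ y → ≡-trans (Σ-*ˡ (allVecs k n) [ eqFin x y ] _)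
           (cong ([ eqFin x y ] *_) (Σ-allVecs-eqState k n xs (λ ys → c (y Vec.∷ ys))))) ⟩
    Σ[ allFin k ] (λ y → [ eqFin x y ] * c (y Vec.∷ xs))
      ≡⟨ Σ-allFin-eqFin k x (λ y → c (y Vec.∷ xs)) ⟩
    c (x Vec.∷ xs) ∎
    where
    open ≡-Reasoning
    split-indicator : ∀ y ys → [ eqState (x Vec.∷ xs) (y Vec.∷ ys) ] * c (y Vec.∷ ys)
                             ≡ [ eqFin x y ] * ([ eqState xs ys ] * c (y Vec.∷ ys))
    split-indicator y ys = ≡-trans (cong (λ b → [ b ] * c (y Vec.∷ ys)) (eqState-∷ x y xs ys))
      (≡-trans (cong (_* c (y Vec.∷ ys)) ([]-∧ (eqFin x y) (eqState xs ys)))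
        (*-assoc [ eqFin x y ] [ eqState xs ys ] (c (y Vec.∷ ys))))

  module _ {A : Set} (f : A → ℚ) where

    maxOver-ub : ∀ xs {y} → y ∈ xs → f y ≤ maxOver xs f
    maxOver-ub (x ∷ xs) y∈ = foldr-ub xs y∈
      where
      foldr-ub : ∀ xs {y} → y ∈ x ∷ xs → f y ≤ List.foldr (λ z m → f z ⊔ m) (f x) xs
      foldr-ub []       (here refl) = ≤-refl
      foldr-ub (z ∷ zs) (here refl) = ≤-trans (foldr-ub zs (here refl)) (p≤q⊔p (f z) _)
      foldr-ub (z ∷ zs) (there (here refl)) = p≤p⊔q (f z) _
      foldr-ub (z ∷ zs) (there (there y∈zs)) = ≤-trans (foldr-ub zs (there y∈zs)) (p≤q⊔p (f z) _)

    maxOver-attained : ∀ xs {y} → y ∈ xs → ∃ λ z → z ∈ xs × maxOver xs f ≡ f z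
    maxOver-attained (x ∷ xs) _
      with foldr-selective ⊔-sel (f x) (map f xs)
    ... | inj₁ max≡fx = x , here refl , ≡-trans (sym (ListP.foldr-map _⊔_ f (f x) xs)) max≡fx
    ... | inj₂ max∈ with ∈-map⁻ f max∈
    ...   | z , z∈xs , max≡fz = z , there z∈xs , ≡-trans (sym (ListP.foldr-map _⊔_ f (f x) xs)) max≡fz

  module _ {k : ℕ} (f : Fin k → ℚ) where

    fmax-ub : ∀ j → f j ≤ fmax f
    fmax-ub j = maxOver-ub f (allFin k) (∈-allFin j)

    fstar-ub : ∀ j → f j ≢ fmax f → f j ≤ fstar f
    fstar-ub j j-nonmax = maxOver-ub f _ (∈-filter⁺ (λ i → ¬? (f i ≟ fmax f)) (∈-allFin j) j-nonmax)

    fstar<fmax : (∃ λ j → f j ≢ fmax f) → fstar f < fmax f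
    fstar<fmax (j , j-nonmax)
      with maxOver-attained f _ (∈-filter⁺ (λ i → ¬? (f i ≟ fmax f)) (∈-allFin j) j-nonmax)
    ... | i , i∈ , fstar≡fi = subst (_< fmax f) (sym fstar≡fi)
            (≤∧≢⇒< (fmax-ub i) (proj₂ (∈-filter⁻ (λ i → ¬? (f i ≟ fmax f)) {xs = allFin k} i∈)))

    two-maxima⇒2≤|τmax| : ∀ {α β} → α ≢ β → f α ≡ fmax f → f β ≡ fmax f →
                          2 ℕ.≤ length (tauMaxList f)
    two-maxima⇒2≤|τmax| α≢β αmax βmax =
      two-members (∈-filter⁺ (λ j → f j ≟ fmax f) (∈-allFin _) αmax)
                  (∈-filter⁺ (λ j → f j ≟ fmax f) (∈-allFin _) βmax) α≢β
      where
      two-members : ∀ {xs : List (Fin k)} {a b} → a ∈ xs → b ∈ xs → a ≢ b → 2 ℕ.≤ length xs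
      two-members {_ ∷ []}    (here refl) (here refl) a≢b = ⊥-elim (a≢b refl)
      two-members {_ ∷ _ ∷ _} _ _ _ = s≤s (s≤s z≤n)

  module Step {n k : ℕ} (G : Graph n) (f : Fin k → ℚ) (f≥0 : ∀ j → 0ℚ ≤ f j) where

    W : State n k → ℚ
    W = totalFitness f

    W-nonNeg : ∀ S → 0ℚ ≤ W S
    W-nonNeg S = Σ-nonNeg (allFin n) (λ u → f≥0 (lookup S u))

    c : Fin n → ℚ
    c v = inv (ℕ→ℚ (deg G v))

    c-nonNeg : ∀ v → 0ℚ ≤ c v
    c-nonNeg v = inv-nonNeg (ℕ→ℚ-nonNeg (deg G v))

    -- The probability that v reproduces onto one given neighbour.
    rate : State n k → Fin n → ℚ
    rate S v = f (lookup S v) * inv (W S) * c v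

    rate-nonNeg : ∀ S v → 0ℚ ≤ rate S v
    rate-nonNeg S v = *-nonNeg (*-nonNeg (f≥0 _) (inv-nonNeg (W-nonNeg S))) (c-nonNeg v)

    E[_]_ : State n k → (Fin n → Fin n → ℚ) → ℚ
    E[ S ] F = Σ[ allFin n ] λ v → Σ[ nbrs G v ] λ w → rate S v * F v w

    trans-summand : ∀ S v → (f (lookup S v) ÷₀ W S) * (1ℚ ÷₀ ℕ→ℚ (deg G v)) ≡ rate S v
    trans-summand S v =
      cong₂ _*_ (÷₀≡*inv (f (lookup S v)) (W S)) (≡-trans (÷₀≡*inv 1ℚ (ℕ→ℚ (deg G v))) (*-identityˡ (c v)))

    trans-nonNeg : ∀ S S′ → 0ℚ ≤ trans G f S S′
    trans-nonNeg S S′ = Σ-nonNeg (allFin n) λ v → Σ-nonNeg (nbrs G v) λ w →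
      *-nonNeg ([]-nonNeg (eqState (update S v w) S′))
               (subst (0ℚ ≤_) (sym (trans-summand S v)) (rate-nonNeg S v))

    Σ-trans : ∀ S (h : State n k → ℚ) →
              Σ[ allVecs k n ] (λ S′ → trans G f S S′ * h S′) ≡ E[ S ] (λ v w → h (update S v w))
    Σ-trans S h = begin
      Σ[ Ω ] (λ S′ → trans G f S S′ * h S′)
        ≡⟨ Σ-cong Ω (λ S′ → ≡-trans (sym (Σ-*ʳ V (h S′) _)) (Σ-cong V (λ v → sym (Σ-*ʳ (nbrs G v) (h S′) _)))) ⟩
      Σ[ Ω ] (λ S′ → Σ[ V ] λ v → Σ[ nbrs G v ] λ w → move v w S′ * h S′)
        ≡⟨ Σ-comm Ω V _ ⟩
      Σ[ V ] (λ v → Σ[ Ω ] λ S′ → Σ[ nbrs G v ] λ w → move v w S′ * h S′)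
        ≡⟨ Σ-cong V (λ v → Σ-comm Ω (nbrs G v) _) ⟩
      Σ[ V ] (λ v → Σ[ nbrs G v ] λ w → Σ[ Ω ] λ S′ → move v w S′ * h S′)
        ≡⟨ Σ-cong V (λ v → Σ-cong (nbrs G v) (λ w → Σ-cong Ω (λ S′ → reassociate v w S′))) ⟩
      Σ[ V ] (λ v → Σ[ nbrs G v ] λ w → Σ[ Ω ] λ S′ → [ eqState (update S v w) S′ ] * (rate S v * h S′))
        ≡⟨ Σ-cong V (λ v → Σ-cong (nbrs G v) (λ w →
             Σ-allVecs-eqState k n (update S v w) (λ S′ → rate S v * h S′))) ⟩
      E[ S ] (λ v w → h (update S v w)) ∎
      where
      open ≡-Reasoning
      Ω : List (State n k)
      Ω = allVecs k n
      V : List (Fin n)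
      V = allFin n
      move : Fin n → Fin n → State n k → ℚ
      move v w S′ = [ eqState (update S v w) S′ ] * ((f (lookup S v) ÷₀ W S) * (1ℚ ÷₀ ℕ→ℚ (deg G v)))
      reassociate : ∀ v w S′ → move v w S′ * h S′ ≡ [ eqState (update S v w) S′ ] * (rate S v * h S′)
      reassociate v w S′ = ≡-trans (cong (λ r → [ eqState (update S v w) S′ ] * r * h S′) (trans-summand S v))
                                   (*-assoc [ eqState (update S v w) S′ ] (rate S v) (h S′))

    E-cong : ∀ S {F H : Fin n → Fin n → ℚ} → (∀ v w → F v w ≡ H v w) → E[ S ] F ≡ E[ S ] H
    E-cong S F≡H = Σ-cong (allFin n) λ v → Σ-cong (nbrs G v) λ w → cong (rate S v *_) (F≡H v w)

    E-+ : ∀ S (F H : Fin n → Fin n → ℚ) → E[ S ] (λ v w → F v w + H v w) ≡ E[ S ] F + E[ S ] H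
    E-+ S F H = ≡-trans
      (Σ-cong (allFin n) λ v → ≡-trans
        (Σ-cong (nbrs G v) λ w → *-distribˡ-+ (rate S v) (F v w) (H v w))
        (Σ-+ (nbrs G v) _ _))
      (Σ-+ (allFin n) _ _)

    E-sub : ∀ S (F H : Fin n → Fin n → ℚ) → E[ S ] (λ v w → F v w - H v w) ≡ E[ S ] F - E[ S ] H
    E-sub S F H = ≡-trans
      (Σ-cong (allFin n) λ v → ≡-trans
        (Σ-cong (nbrs G v) λ w → solve 3 (λ r a b → r :* (a :- b) := r :* a :- r :* b) refl (rate S v) (F v w) (H v w))
        (Σ-sub (nbrs G v) _ _))
      (Σ-sub (allFin n) _ _)

    E-*ˡ : ∀ S (a : ℚ) (F : Fin n → Fin n → ℚ) → E[ S ] (λ v w → a * F v w) ≡ a * E[ S ] F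
    E-*ˡ S a F = ≡-trans
      (Σ-cong (allFin n) λ v → ≡-trans
        (Σ-cong (nbrs G v) λ w → solve 3 (λ a r x → r :* (a :* x) := a :* (r :* x)) refl a (rate S v) (F v w))
        (Σ-*ˡ (nbrs G v) a _))
      (Σ-*ˡ (allFin n) a _)

    -- Σ_v deg(v) f(S v) / (W(S) deg(v)) is 1, or 0 on the junk value 1/0 = 0.
    E-1≤1 : ∀ S → E[ S ] (λ _ _ → 1ℚ) ≤ 1ℚ
    E-1≤1 S = begin
      E[ S ] (λ _ _ → 1ℚ)
        ≡⟨ Σ-cong V (λ v → Σ-const (nbrs G v) (rate S v * 1ℚ)) ⟩
      Σ[ V ] (λ v → ℕ→ℚ (deg G v) * (rate S v * 1ℚ))
        ≡⟨ Σ-cong V (λ v → solve 4 (λ d x i cv → d :* (x :* i :* cv :* con 1ℚ) := x :* i :* (d :* cv)) refl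
                            (ℕ→ℚ (deg G v)) (f (lookup S v)) (inv (W S)) (c v)) ⟩
      Σ[ V ] (λ v → f (lookup S v) * inv (W S) * (ℕ→ℚ (deg G v) * c v))
        ≤⟨ Σ-mono-≤ V (λ v → *-monoˡ-≤-0≤ (*-nonNeg (f≥0 _) (inv-nonNeg (W-nonNeg S))) (p*inv[p]≤1 (ℕ→ℚ (deg G v)))) ⟩
      Σ[ V ] (λ v → f (lookup S v) * inv (W S) * 1ℚ)
        ≡⟨ Σ-cong V (λ v → *-identityʳ _) ⟩
      Σ[ V ] (λ v → f (lookup S v) * inv (W S))
        ≡⟨ Σ-*ʳ V (inv (W S)) (λ v → f (lookup S v)) ⟩
      W S * inv (W S)
        ≤⟨ p*inv[p]≤1 (W S) ⟩
      1ℚ ∎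
      where
      open ≤-Reasoning
      V : List (Fin n)
      V = allFin n

    Σ-trans≤1 : ∀ S → Σ[ allVecs k n ] (trans G f S) ≤ 1ℚ
    Σ-trans≤1 S = subst (_≤ 1ℚ)
      (sym (≡-trans (Σ-cong (allVecs k n) (λ S′ → sym (*-identityʳ (trans G f S S′)))) (Σ-trans S (λ _ → 1ℚ))))
      (E-1≤1 S)

    E-c-sub≤ : ∀ S {a} (F : Fin n → Fin n → ℚ) → 0ℚ ≤ a → E[ S ] (λ v w → a - F v w) ≤ a - E[ S ] F
    E-c-sub≤ S {a} F 0≤a = begin
      E[ S ] (λ v w → a - F v w)                ≡⟨ E-sub S (λ _ _ → a) F ⟩
      E[ S ] (λ _ _ → a) - E[ S ] F             ≡⟨ cong (_- E[ S ] F) (≡-trans (E-cong S (λ _ _ → sym (*-identityʳ a))) (E-*ˡ S a _)) ⟩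
      a * E[ S ] (λ _ _ → 1ℚ) - E[ S ] F        ≤⟨ +-monoˡ-≤ (- E[ S ] F) (subst (a * E[ S ] (λ _ _ → 1ℚ) ≤_) (*-identityʳ a) (*-monoˡ-≤-0≤ 0≤a (E-1≤1 S))) ⟩
      a - E[ S ] F                              ∎
      where open ≤-Reasoning

    drift-from-decrease : ∀ (g : State n k → ℚ) (F : State n k → Fin n → Fin n → ℚ) →
      (∀ S v w → g (update S v w) ≡ g S - F S v w) →
      ∀ S {δ} → 0ℚ ≤ g S → δ ≤ E[ S ] (F S) →
      Σ[ allVecs k n ] (λ S′ → trans G f S S′ * g S′) + δ ≤ g S
    drift-from-decrease g F g-update S {δ} 0≤gS δ≤EF = begin
      Σ[ allVecs k n ] (λ S′ → trans G f S S′ * g S′) + δ  ≡⟨ cong (_+ δ) (≡-trans (Σ-trans S g) (E-cong S (g-update S))) ⟩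
      E[ S ] (λ v w → g S - F S v w) + δ                  ≤⟨ +-monoˡ-≤ δ (E-c-sub≤ S (F S) 0≤gS) ⟩
      g S - E[ S ] (F S) + δ                              ≤⟨ +-monoʳ-≤ (g S - E[ S ] (F S)) δ≤EF ⟩
      g S - E[ S ] (F S) + E[ S ] (F S)                   ≡⟨ solve 2 (λ a b → a :- b :+ b := a) refl (g S) (E[ S ] (F S)) ⟩
      g S                                                 ∎
      where open ≤-Reasoning

  module Drift {n k : ℕ} (G : Graph n) (f : Fin k → ℚ) (f≥0 : ∀ j → 0ℚ ≤ f j)
    (D : State n k → ℚ) (D-dist : IsDistribution D) (α : Fin k)
    (g : State n k → ℚ) (G₀ δ : ℚ) (0≤g : ∀ S → 0ℚ ≤ g S) (g≤G₀ : ∀ S → g S ≤ G₀)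
    (drift : ∀ S → absorbed α S ≡ false → Σ[ allVecs k n ] (λ S′ → trans G f S S′ * g S′) + δ ≤ g S)
    where

    open Step G f f≥0 using (trans-nonNeg; Σ-trans≤1)

    private
      Ω : List (State n k)
      Ω = allVecs k n
      r : ℕ → State n k → ℚ
      r = notAbsorbedMass G f D α

    alive : State n k → ℚ
    alive S = [ not (absorbed α S) ]

    -- For the absorption time A: Pr≥ t = Pr(A ≥ t), Pr> t = Pr(A > t) and Φ t = E[g(M_t); A > t].
    Pr≥ Pr> Φ : ℕ → ℚ
    Pr≥ t = Σ[ Ω ] (r t)
    Pr> t = Σ[ Ω ] (λ S → alive S * r t S)
    Φ   t = Σ[ Ω ] (λ S → alive S * r t S * g S)

    tailSum : ℕ → ℚ
    tailSum zero    = 0ℚ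
    tailSum (suc T) = tailSum T + Pr> T

    r-nonNeg : ∀ t S → 0ℚ ≤ r t S
    r-nonNeg zero    S  = proj₁ D-dist S
    r-nonNeg (suc t) S′ = Σ-nonNeg Ω λ S →
      *-nonNeg ([]-nonNeg (not (absorbed α S))) (*-nonNeg (r-nonNeg t S) (trans-nonNeg S S′))

    alive·r-nonNeg : ∀ t S → 0ℚ ≤ alive S * r t S
    alive·r-nonNeg t S = *-nonNeg ([]-nonNeg (not (absorbed α S))) (r-nonNeg t S)

    Σ-r-suc : ∀ t (h : State n k → ℚ) →
              Σ[ Ω ] (λ S′ → r (suc t) S′ * h S′) ≡ Σ[ Ω ] (λ S → alive S * r t S * Σ[ Ω ] (λ S′ → trans G f S S′ * h S′))
    Σ-r-suc t h = begin
      Σ[ Ω ] (λ S′ → r (suc t) S′ * h S′)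
        ≡⟨ Σ-cong Ω (λ S′ → sym (Σ-*ʳ Ω (h S′) _)) ⟩
      Σ[ Ω ] (λ S′ → Σ[ Ω ] λ S → alive S * (r t S * trans G f S S′) * h S′)
        ≡⟨ Σ-comm Ω Ω _ ⟩
      Σ[ Ω ] (λ S → Σ[ Ω ] λ S′ → alive S * (r t S * trans G f S S′) * h S′)
        ≡⟨ Σ-cong Ω (λ S → ≡-trans (Σ-cong Ω (λ S′ → solve 4 (λ a x p y → a :* (x :* p) :* y := a :* x :* (p :* y)) refl
                                              (alive S) (r t S) (trans G f S S′) (h S′)))
                                    (Σ-*ˡ Ω (alive S * r t S) _)) ⟩
      Σ[ Ω ] (λ S → alive S * r t S * Σ[ Ω ] (λ S′ → trans G f S S′ * h S′)) ∎
      where open ≡-Reasoning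

    Pr≥-suc≤Pr> : ∀ t → Pr≥ (suc t) ≤ Pr> t
    Pr≥-suc≤Pr> t = begin
      Pr≥ (suc t)                                     ≡⟨ Σ-cong Ω (λ S′ → *-identityʳ (r (suc t) S′)) ⟨
      Σ[ Ω ] (λ S′ → r (suc t) S′ * 1ℚ)               ≡⟨ Σ-r-suc t (λ _ → 1ℚ) ⟩
      Σ[ Ω ] (λ S → alive S * r t S * Σ[ Ω ] (λ S′ → trans G f S S′ * 1ℚ))
        ≤⟨ Σ-mono-≤ Ω (λ S → *-monoˡ-≤-0≤ (alive·r-nonNeg t S)
             (subst (_≤ 1ℚ) (Σ-cong Ω (λ S′ → sym (*-identityʳ (trans G f S S′)))) (Σ-trans≤1 S))) ⟩
      Σ[ Ω ] (λ S → alive S * r t S * 1ℚ)             ≡⟨ Σ-cong Ω (λ S → *-identityʳ _) ⟩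
      Pr> t                                           ∎
      where open ≤-Reasoning

    PrA≡+Pr>≡Pr≥ : ∀ t → PrA≡ G f D α t + Pr> t ≡ Pr≥ t
    PrA≡+Pr>≡Pr≥ t = ≡-trans (sym (Σ-+ Ω _ _)) (Σ-cong Ω λ S → begin
      [ absorbed α S ] * r t S + alive S * r t S    ≡⟨ *-distribʳ-+ (r t S) [ absorbed α S ] (alive S) ⟨
      ([ absorbed α S ] + alive S) * r t S          ≡⟨ cong (_* r t S) ([b]+[not-b]≡1 (absorbed α S)) ⟩
      1ℚ * r t S                                    ≡⟨ *-identityˡ (r t S) ⟩
      r t S                                         ∎)
      where open ≡-Reasoning

    Φ-step : ∀ t → Φ (suc t) + δ * Pr> t ≤ Φ t
    Φ-step t = begin
      Φ (suc t) + δ * Pr> t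
        ≤⟨ +-monoˡ-≤ (δ * Pr> t) (Σ-mono-≤ Ω (λ S′ → subst (_≤ r (suc t) S′ * g S′)
             (sym (*-assoc (alive S′) (r (suc t) S′) (g S′)))
             ([]*-≤ (not (absorbed α S′)) (*-nonNeg (r-nonNeg (suc t) S′) (0≤g S′))))) ⟩
      Σ[ Ω ] (λ S′ → r (suc t) S′ * g S′) + δ * Pr> t
        ≡⟨ cong₂ _+_ (Σ-r-suc t g) (≡-trans (sym (Σ-*ˡ Ω δ _)) (Σ-cong Ω (λ S → *-comm δ _))) ⟩
      Σ[ Ω ] (λ S → alive S * r t S * next S) + Σ[ Ω ] (λ S → alive S * r t S * δ)
        ≡⟨ Σ-+ Ω _ _ ⟨
      Σ[ Ω ] (λ S → alive S * r t S * next S + alive S * r t S * δ)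
        ≡⟨ Σ-cong Ω (λ S → *-distribˡ-+ (alive S * r t S) (next S) δ) ⟨
      Σ[ Ω ] (λ S → alive S * r t S * (next S + δ))
        ≤⟨ Σ-mono-≤ Ω drift-where-alive ⟩
      Φ t ∎
      where
      open ≤-Reasoning
      next : State n k → ℚ
      next S = Σ[ Ω ] (λ S′ → trans G f S S′ * g S′)
      drift-where-alive : ∀ S → alive S * r t S * (next S + δ) ≤ alive S * r t S * g S
      drift-where-alive S = indicator-guarded (absorbed α S) (r-nonNeg t S) (drift S)

    Φ₀≤G₀ : Φ 0 ≤ G₀
    Φ₀≤G₀ = begin
      Φ 0                      ≤⟨ Σ-mono-≤ Ω (λ S → *-mono-≤-0≤ (alive·r-nonNeg 0 S) ([]*-≤ (not (absorbed α S)) (proj₁ D-dist S)) (0≤g S) (g≤G₀ S)) ⟩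
      Σ[ Ω ] (λ S → D S * G₀)  ≡⟨ Σ-*ʳ Ω G₀ D ⟩
      Σ[ Ω ] D * G₀            ≡⟨ cong (_* G₀) (proj₂ D-dist) ⟩
      1ℚ * G₀                  ≡⟨ *-identityˡ G₀ ⟩
      G₀                       ∎
      where open ≤-Reasoning

    δ*tailSum+Φ≤Φ₀ : ∀ T → δ * tailSum T + Φ T ≤ Φ 0
    δ*tailSum+Φ≤Φ₀ zero    = ≤-reflexive (≡-trans (cong (_+ Φ 0) (*-zeroʳ δ)) (+-identityˡ (Φ 0)))
    δ*tailSum+Φ≤Φ₀ (suc T) = begin
      δ * (tailSum T + Pr> T) + Φ (suc T)
        ≡⟨ solve 4 (λ d x y z → d :* (x :+ y) :+ z := d :* x :+ (z :+ d :* y)) refl δ (tailSum T) (Pr> T) (Φ (suc T)) ⟩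
      δ * tailSum T + (Φ (suc T) + δ * Pr> T)   ≤⟨ +-monoʳ-≤ (δ * tailSum T) (Φ-step T) ⟩
      δ * tailSum T + Φ T                       ≤⟨ δ*tailSum+Φ≤Φ₀ T ⟩
      Φ 0                                       ∎
      where open ≤-Reasoning

    δ*tailSum≤G₀ : ∀ T → δ * tailSum T ≤ G₀
    δ*tailSum≤G₀ T = ≤-trans (p≤p+q (Φ-nonNeg T)) (≤-trans (δ*tailSum+Φ≤Φ₀ T) Φ₀≤G₀)
      where
      Φ-nonNeg : ∀ t → 0ℚ ≤ Φ t
      Φ-nonNeg t = Σ-nonNeg Ω (λ S → *-nonNeg (alive·r-nonNeg t S) (0≤g S))

    -- Summation by parts: Σ_{t<T} t Pr(A = t) + T Pr(A ≥ T) = Σ_{t<T} Pr(A > t).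
    partialExp+T*Pr≥≤tailSum : ∀ T → partialExp G f D α T + ℕ→ℚ T * Pr≥ T ≤ tailSum T
    partialExp+T*Pr≥≤tailSum zero = ≤-reflexive (≡-trans (+-identityˡ _) (*-zeroˡ (Pr≥ 0)))
    partialExp+T*Pr≥≤tailSum (suc T) = begin
      E + ℕ→ℚ T * PrA≡ G f D α T + ℕ→ℚ (suc T) * Pr≥ (suc T)
        ≤⟨ +-monoʳ-≤ (E + ℕ→ℚ T * PrA≡ G f D α T) (*-monoˡ-≤-0≤ (ℕ→ℚ-nonNeg (suc T)) (Pr≥-suc≤Pr> T)) ⟩
      E + ℕ→ℚ T * PrA≡ G f D α T + ℕ→ℚ (suc T) * Pr> T
        ≡⟨ cong (λ x → E + ℕ→ℚ T * PrA≡ G f D α T + x * Pr> T) (ℕ→ℚ-+ 1 T) ⟩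
      E + ℕ→ℚ T * PrA≡ G f D α T + (1ℚ + ℕ→ℚ T) * Pr> T
        ≡⟨ solve 4 (λ e t p x → e :+ t :* p :+ (con 1ℚ :+ t) :* x := e :+ t :* (p :+ x) :+ x) refl
             E (ℕ→ℚ T) (PrA≡ G f D α T) (Pr> T) ⟩
      E + ℕ→ℚ T * (PrA≡ G f D α T + Pr> T) + Pr> T
        ≡⟨ cong (λ x → E + ℕ→ℚ T * x + Pr> T) (PrA≡+Pr>≡Pr≥ T) ⟩
      E + ℕ→ℚ T * Pr≥ T + Pr> T
        ≤⟨ +-monoˡ-≤ (Pr> T) (partialExp+T*Pr≥≤tailSum T) ⟩
      tailSum T + Pr> T ∎
      where
      open ≤-Reasoning
      E : ℚ
      E = partialExp G f D α T

    expectedAbsorption≤ : ∀ B → 0ℚ < δ → G₀ ≤ δ * B → ExpA≤ G f D α B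
    expectedAbsorption≤ B 0<δ G₀≤δB T = ≤-trans partialExp≤tailSum
      (*-cancelˡ-≤-0< 0<δ (≤-trans (δ*tailSum≤G₀ T) G₀≤δB))
      where
      partialExp≤tailSum : partialExp G f D α T ≤ tailSum T
      partialExp≤tailSum = ≤-trans (p≤p+q (*-nonNeg (ℕ→ℚ-nonNeg T) (Σ-nonNeg Ω (r-nonNeg T))))
                                   (partialExp+T*Pr≥≤tailSum T)

  module Potential {n k : ℕ} (G : Graph n) (f : Fin k → ℚ) (f≥0 : ∀ j → 0ℚ ≤ f j) (α : Fin k) where

    open Step G f f≥0

    χ : State n k → Fin n → ℚ
    χ S u = [ eqFin (lookup S u) α ]

    χ-nonNeg : ∀ S u → 0ℚ ≤ χ S u
    χ-nonNeg S u = []-nonNeg (eqFin (lookup S u) α)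

    φ : State n k → ℚ
    φ S = Σ[ allFin n ] (λ u → χ S u * c u)

    Δ : State n k → Fin n → Fin n → ℚ
    Δ S v w = (χ S v - χ S w) * c w

    χ-update : ∀ S v w u → χ (update S v w) u ≡ χ S u + [ eqFin w u ] * (χ S v - χ S w)
    χ-update S v w u with w Fin.≟ u
    ... | yes refl = ≡-trans (cong (λ s → [ eqFin s α ]) (VecP.lookup∘update w S (lookup S v)))
                       (solve 2 (λ a b → a := b :+ con 1ℚ :* (a :- b)) refl (χ S v) (χ S w))
    ... | no w≢u   = ≡-trans (cong (λ s → [ eqFin s α ]) (VecP.lookup∘update′ (w≢u ∘ sym) S (lookup S v)))
                       (solve 2 (λ a b → a := a :+ con 0ℚ :* b) refl (χ S u) (χ S v - χ S w))

    φ-update : ∀ S v w → φ (update S v w) ≡ φ S + Δ S v w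
    φ-update S v w = begin
      φ (update S v w)
        ≡⟨ Σ-cong (allFin n) summand ⟩
      Σ[ allFin n ] (λ u → χ S u * c u + [ eqFin w u ] * ((χ S v - χ S w) * c u))
        ≡⟨ Σ-+ (allFin n) _ _ ⟩
      φ S + Σ[ allFin n ] (λ u → [ eqFin w u ] * ((χ S v - χ S w) * c u))
        ≡⟨ cong (φ S +_) (Σ-allFin-eqFin n w (λ u → (χ S v - χ S w) * c u)) ⟩
      φ S + Δ S v w ∎
      where
      open ≡-Reasoning
      summand : ∀ u → χ (update S v w) u * c u ≡ χ S u * c u + [ eqFin w u ] * ((χ S v - χ S w) * c u)
      summand u = ≡-trans (cong (_* c u) (χ-update S v w u))
        (solve 4 (λ a e d x → (a :+ e :* d) :* x := a :* x :+ e :* (d :* x)) refl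
          (χ S u) [ eqFin w u ] (χ S v - χ S w) (c u))

    φ-nonNeg : ∀ S → 0ℚ ≤ φ S
    φ-nonNeg S = Σ-nonNeg (allFin n) (λ u → *-nonNeg (χ-nonNeg S u) (c-nonNeg u))

    φ≤n : ∀ S → φ S ≤ ℕ→ℚ n
    φ≤n S = begin
      φ S                                 ≤⟨ Σ-mono-≤ (allFin n) (λ u → subst (χ S u * c u ≤_) (*-identityˡ 1ℚ)
                                               (*-mono-≤-0≤ (χ-nonNeg S u) ([]-≤1 (eqFin (lookup S u) α)) (c-nonNeg u) (c≤1 u))) ⟩
      Σ[ allFin n ] (λ _ → 1ℚ)            ≡⟨ Σ-const (allFin n) 1ℚ ⟩
      ℕ→ℚ (length (allFin n)) * 1ℚ        ≡⟨ cong (λ m → ℕ→ℚ m * 1ℚ) (ListP.length-tabulate {n = n} (λ i → i)) ⟩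
      ℕ→ℚ n * 1ℚ                          ≡⟨ *-identityʳ (ℕ→ℚ n) ⟩
      ℕ→ℚ n                               ∎
      where
      open ≤-Reasoning
      c≤1 : ∀ u → c u ≤ 1ℚ
      c≤1 u with deg G u
      ... | zero  = 0≤1
      ... | suc d = inv-antimono-≤ 0<1 (ℕ→ℚ-mono-≤ (s≤s (z≤n {d})))

    flux : State n k → Fin n → Fin n → ℚ
    flux S v w = rate S v * Δ S v w + rate S w * Δ S w v

    flux-comm : ∀ S v w → flux S v w ≡ flux S w v
    flux-comm S v w = +-comm (rate S v * Δ S v w) (rate S w * Δ S w v)

    flux-formula : ∀ S v w →
      flux S v w ≡ inv (W S) * c v * c w * ((χ S v - χ S w) * (f (lookup S v) - f (lookup S w)))
    flux-formula S v w =
      solve 7 (λ fv fw i cv cw xv xw → fv :* i :* cv :* ((xv :- xw) :* cw) :+ fw :* i :* cw :* ((xw :- xv) :* cv)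
                                     := i :* cv :* cw :* ((xv :- xw) :* (fv :- fw))) refl
        (f (lookup S v)) (f (lookup S w)) (inv (W S)) (c v) (c w) (χ S v) (χ S w)

    Σ-nbrs : ∀ v (F : Fin n → ℚ) → Σ[ nbrs G v ] F ≡ Σ[ allFin n ] (λ w → [ adj G v w ] * F w)
    Σ-nbrs v = Σ-filter (λ w → BoolP.T? (adj G v w)) (allFin n)

    -- Pairing each move v → w with the reverse move w → v.
    E[Δ]+E[Δ] : ∀ S → E[ S ] (Δ S) + E[ S ] (Δ S) ≡ Σ[ allFin n ] (λ v → Σ[ allFin n ] (λ w → [ adj G v w ] * flux S v w))
    E[Δ]+E[Δ] S = begin
      E[ S ] (Δ S) + E[ S ] (Δ S)
        ≡⟨ cong₂ _+_ (Σ-cong V (λ v → Σ-nbrs v (λ w → rate S v * Δ S v w))) reversed ⟩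
      Σ[ V ] (λ v → Σ[ V ] (λ w → [ adj G v w ] * (rate S v * Δ S v w)))
        + Σ[ V ] (λ v → Σ[ V ] (λ w → [ adj G v w ] * (rate S w * Δ S w v)))
        ≡⟨ Σ-+ V _ _ ⟨
      Σ[ V ] (λ v → Σ[ V ] (λ w → [ adj G v w ] * (rate S v * Δ S v w))
                    + Σ[ V ] (λ w → [ adj G v w ] * (rate S w * Δ S w v)))
        ≡⟨ Σ-cong V (λ v → sym (≡-trans (Σ-cong V (λ w → *-distribˡ-+ [ adj G v w ] _ _)) (Σ-+ V _ _))) ⟩
      Σ[ V ] (λ v → Σ[ V ] (λ w → [ adj G v w ] * flux S v w)) ∎
      where
      open ≡-Reasoning
      V : List (Fin n)
      V = allFin n
      reversed : E[ S ] (Δ S) ≡ Σ[ V ] (λ v → Σ[ V ] (λ w → [ adj G v w ] * (rate S w * Δ S w v)))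
      reversed = begin
        E[ S ] (Δ S)
          ≡⟨ Σ-cong V (λ w → Σ-nbrs w (λ v → rate S w * Δ S w v)) ⟩
        Σ[ V ] (λ w → Σ[ V ] (λ v → [ adj G w v ] * (rate S w * Δ S w v)))
          ≡⟨ Σ-comm V V _ ⟩
        Σ[ V ] (λ v → Σ[ V ] (λ w → [ adj G w v ] * (rate S w * Δ S w v)))
          ≡⟨ Σ-cong V (λ v → Σ-cong V (λ w → cong (λ b → [ b ] * (rate S w * Δ S w v)) (symmetric G w v))) ⟩
        Σ[ V ] (λ v → Σ[ V ] (λ w → [ adj G v w ] * (rate S w * Δ S w v))) ∎

    χ≡1 : ∀ S {u} → lookup S u ≡ α → χ S u ≡ 1ℚ
    χ≡1 S {u} S[u]≡α = cong [_] (≡-trans (isYes≗does (lookup S u Fin.≟ α)) (dec-true (lookup S u Fin.≟ α) S[u]≡α))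

    χ≡0 : ∀ S {x} → lookup S x ≢ α → χ S x ≡ 0ℚ
    χ≡0 S {x} S[x]≢α = cong [_] (≡-trans (isYes≗does (lookup S x Fin.≟ α)) (dec-false (lookup S x Fin.≟ α) S[x]≢α))

    edge⇒∈nbrs : ∀ {u x} → T (adj G u x) → x ∈ nbrs G u
    edge⇒∈nbrs {u} {x} u~x = ∈-filter⁺ (λ w → BoolP.T? (adj G u w)) (∈-allFin x) u~x

    rate·Δ²≤E[Δ²] : ∀ S {u x} → T (adj G u x) → rate S u * (Δ S u x * Δ S u x) ≤ E[ S ] (λ v w → Δ S v w * Δ S v w)
    rate·Δ²≤E[Δ²] S {u} u~x = ≤-trans
      (∈⇒≤Σ (nbrs G u) (λ w → *-nonNeg (rate-nonNeg S u) (0≤p*p (Δ S u w))) (edge⇒∈nbrs u~x))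
      (∈⇒≤Σ (allFin n) (λ v → Σ-nonNeg (nbrs G v) (λ w → *-nonNeg (rate-nonNeg S v) (0≤p*p (Δ S v w)))) (∈-allFin u))

    module _ (αmax : ∀ j → f j ≤ f α) where

      flux-nonNeg : ∀ S v w → 0ℚ ≤ flux S v w
      flux-nonNeg S v w = subst (0ℚ ≤_) (sym (flux-formula S v w))
        (*-nonNeg (*-nonNeg (*-nonNeg (inv-nonNeg (W-nonNeg S)) (c-nonNeg v)) (c-nonNeg w))
                  (indicator-aligned (eqFin (lookup S v) α) (eqFin (lookup S w) α)
                     (λ e → subst (λ j → f (lookup S w) ≤ f j) (sym (eqFin-sound e)) (αmax _))
                     (λ e → subst (λ j → f (lookup S v) ≤ f j) (sym (eqFin-sound e)) (αmax _))))
        where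
        eqFin-sound : ∀ {i j : Fin k} → eqFin i j ≡ true → i ≡ j
        eqFin-sound e = toWitness (subst T (sym e) _)

      E[Δ]-nonNeg : ∀ S → 0ℚ ≤ E[ S ] (Δ S)
      E[Δ]-nonNeg S = p+p≤q+q⇒p≤q (subst (0ℚ ≤_) (sym (E[Δ]+E[Δ] S))
        (Σ-nonNeg (allFin n) λ v → Σ-nonNeg (allFin n) λ w → *-nonNeg ([]-nonNeg (adj G v w)) (flux-nonNeg S v w)))

      flux≤E[Δ] : ∀ S {u x} → T (adj G u x) → u ≢ x → flux S u x ≤ E[ S ] (Δ S)
      flux≤E[Δ] S {u} {x} u~x u≢x = p+p≤q+q⇒p≤q (begin
        flux S u x + flux S u x   ≤⟨ +-mono-≤ (≤row u~x) (subst (_≤ row x) (flux-comm S x u) (≤row x~u)) ⟩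
        row u + row x             ≤⟨ ∈∧∈⇒≤Σ (allFin n) row-nonNeg (∈-allFin u) (∈-allFin x) u≢x ⟩
        Σ[ allFin n ] row         ≡⟨ E[Δ]+E[Δ] S ⟨
        E[ S ] (Δ S) + E[ S ] (Δ S) ∎)
        where
        open ≤-Reasoning
        row : Fin n → ℚ
        row v = Σ[ allFin n ] (λ w → [ adj G v w ] * flux S v w)
        term-nonNeg : ∀ v w → 0ℚ ≤ [ adj G v w ] * flux S v w
        term-nonNeg v w = *-nonNeg ([]-nonNeg (adj G v w)) (flux-nonNeg S v w)
        row-nonNeg : ∀ v → 0ℚ ≤ row v
        row-nonNeg v = Σ-nonNeg (allFin n) (term-nonNeg v)
        ≤row : ∀ {v w} → T (adj G v w) → flux S v w ≤ row v
        ≤row {v} {w} v~w = subst (_≤ row v)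
          (≡-trans (cong (λ b → [ b ] * flux S v w) (Equivalence.to BoolP.T-≡ v~w)) (*-identityˡ (flux S v w)))
          (∈⇒≤Σ (allFin n) (term-nonNeg v) (∈-allFin w))
        x~u : T (adj G x u)
        x~u = subst T (symmetric G u x) u~x

  crossing-edge : ∀ {A : Set} {R : A → A → Set} {P : A → Set} → Decidable P →
                  ∀ {a b} → Star R a b → P a → ¬ P b → ∃₂ λ u x → R u x × P u × ¬ P x
  crossing-edge P? ε Pa ¬Pb = ⊥-elim (¬Pb Pa)
  crossing-edge P? (_◅_ {j = y} a~y path) Pa ¬Pb with P? y
  ... | yes Py  = crossing-edge P? path Py ¬Pb
  ... | no  ¬Py = _ , y , a~y , Pa , ¬Py

  module _ {k : ℕ} (α : Fin k) where

    countType≢0⇒∃ : ∀ {m} (S : State m k) → countType α S ≢ 0 → ∃ λ u → lookup S u ≡ α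
    countType≢0⇒∃ Vec.[]       count≢0 = ⊥-elim (count≢0 refl)
    countType≢0⇒∃ (y Vec.∷ ys) count≢0 with y Fin.≟ α
    ... | yes y≡α = Fin.zero , y≡α
    ... | no  _   with countType≢0⇒∃ ys count≢0
    ...   | u , ys[u]≡α = Fin.suc u , ys[u]≡α

    countType≢m⇒∃ : ∀ {m} (S : State m k) → countType α S ≢ m → ∃ λ x → lookup S x ≢ α
    countType≢m⇒∃ Vec.[]       count≢m = ⊥-elim (count≢m refl)
    countType≢m⇒∃ (y Vec.∷ ys) count≢m with y Fin.≟ α
    ... | no  y≢α = Fin.zero , y≢α
    ... | yes _   with countType≢m⇒∃ ys (count≢m ∘ cong suc)
    ...   | x , ys[x]≢α = Fin.suc x , ys[x]≢α

    count≡0⇒absorbed : ∀ {n} (S : State n k) → countType α S ≡ 0 → absorbed α S ≡ true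
    count≡0⇒absorbed {n} S count≡0 = cong (λ m → (m ℕ.≡ᵇ 0) ∨ (m ℕ.≡ᵇ n)) count≡0

    count≡n⇒absorbed : ∀ {n} (S : State n k) → countType α S ≡ n → absorbed α S ≡ true
    count≡n⇒absorbed {n} S count≡n = ≡-trans (cong (λ m → (m ℕ.≡ᵇ 0) ∨ (m ℕ.≡ᵇ n)) count≡n)
      (≡-trans (cong ((n ℕ.≡ᵇ 0) ∨_) (Equivalence.to BoolP.T-≡ (ℕP.≡⇒≡ᵇ n n refl))) (BoolP.∨-zeroʳ _))

    boundary-edge : ∀ {n} (G : Graph n) → Connected G → ∀ S → absorbed α S ≡ false →
                    ∃₂ λ u x → T (adj G u x) × lookup S u ≡ α × lookup S x ≢ α
    boundary-edge G conn S alive =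
      let u , S[u]≡α = countType≢0⇒∃ S (dead ∘ count≡0⇒absorbed S)
          x , S[x]≢α = countType≢m⇒∃ S (dead ∘ count≡n⇒absorbed S)
      in crossing-edge (λ v → lookup S v Fin.≟ α) (conn u x) S[u]≡α S[x]≢α
      where
      dead : absorbed α S ≢ true
      dead absorbed = BoolP.not-¬ refl (≡-trans (sym absorbed) alive)

  module MaxFitness {n k : ℕ} {{_ : ℕ.NonZero n}} (G : Graph n) (conn : Connected G)
    (f : Fin k → ℚ) (f≥0 : ∀ j → 0ℚ ≤ f j) (α : Fin k) (0<fα : 0ℚ < f α) (αmax : ∀ j → f j ≤ f α)
    (D : State n k → ℚ) (D-dist : IsDistribution D) where

    open Step G f f≥0
    open Potential G f f≥0 α

    ν : ℚ
    ν = ℕ→ℚ n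

    N : ℕ → ℚ
    N e = ℕ→ℚ (n ^ e)

    0<ν : 0ℚ < ν
    0<ν = ℕ→ℚ-pos (ℕ.>-nonZero⁻¹ n)

    0<N : ∀ e → 0ℚ < N e
    0<N e = ℕ→ℚ-pos (ℕP.m^n>0 n e)

    N-suc : ∀ e → N (suc e) ≡ ν * N e
    N-suc e = ℕ→ℚ-* n (n ^ e)

    N3≡ν³ : N 3 ≡ ν * (ν * (ν * 1ℚ))
    N3≡ν³ = ≡-trans (N-suc 2) (cong (ν *_) (≡-trans (N-suc 1) (cong (ν *_) (N-suc 0))))

    W≤ν*fα : ∀ S → W S ≤ ν * f α
    W≤ν*fα S = begin
      W S                                ≤⟨ Σ-mono-≤ (allFin n) (λ v → αmax (lookup S v)) ⟩
      Σ[ allFin n ] (λ _ → f α)          ≡⟨ Σ-const (allFin n) (f α) ⟩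
      ℕ→ℚ (length (allFin n)) * f α      ≡⟨ cong (λ m → ℕ→ℚ m * f α) (ListP.length-tabulate {n = n} (λ i → i)) ⟩
      ν * f α                            ∎
      where open ≤-Reasoning

    deg≤n : ∀ v → deg G v ℕ.≤ n
    deg≤n v = ℕP.≤-trans (ListP.length-filter (λ w → BoolP.T? (adj G v w)) (allFin n))
                         (ℕP.≤-reflexive (ListP.length-tabulate {n = n} (λ i → i)))

    0<deg : ∀ {v w} → T (adj G v w) → 1 ℕ.≤ deg G v
    0<deg v~w = ∈-length (edge⇒∈nbrs v~w)

    inv-ν≤c : ∀ {v w} → T (adj G v w) → inv ν ≤ c v
    inv-ν≤c {v} v~w = inv-antimono-≤ (ℕ→ℚ-pos (0<deg v~w)) (ℕ→ℚ-mono-≤ (deg≤n v))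

    module Boundary (S : State n k) {u x : Fin n} (u~x : T (adj G u x))
                    (S[u]≡α : lookup S u ≡ α) (S[x]≢α : lookup S x ≢ α) where

      x~u : T (adj G x u)
      x~u = subst T (symmetric G u x) u~x

      u≢x : u ≢ x
      u≢x u≡x = S[x]≢α (subst (λ v → lookup S v ≡ α) u≡x S[u]≡α)

      0<W : 0ℚ < W S
      0<W = <-≤-trans 0<fα (subst (_≤ W S) (cong f S[u]≡α)
              (∈⇒≤Σ (allFin n) (λ v → f≥0 (lookup S v)) (∈-allFin u)))

      -- W ≤ n f(α) and every degree is at most n.
      inv[fα*n³]≤inv[W]*c*c : inv (f α * N 3) ≤ inv (W S) * c u * c x
      inv[fα*n³]≤inv[W]*c*c = begin
        inv (f α * N 3)                                        ≤⟨ inv-antimono-≤ 0<W·du·dx W·du·dx≤fα*N3 ⟩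
        inv (W S * ℕ→ℚ (deg G u) * ℕ→ℚ (deg G x))             ≡⟨ inv-* (W S * ℕ→ℚ (deg G u)) (ℕ→ℚ (deg G x)) ⟩
        inv (W S * ℕ→ℚ (deg G u)) * c x                        ≡⟨ cong (_* c x) (inv-* (W S) (ℕ→ℚ (deg G u))) ⟩
        inv (W S) * c u * c x                                  ∎
        where
        open ≤-Reasoning
        0<W·du·dx : 0ℚ < W S * ℕ→ℚ (deg G u) * ℕ→ℚ (deg G x)
        0<W·du·dx = *-pos (*-pos 0<W (ℕ→ℚ-pos (0<deg u~x))) (ℕ→ℚ-pos (0<deg x~u))
        W·du·dx≤fα*N3 : W S * ℕ→ℚ (deg G u) * ℕ→ℚ (deg G x) ≤ f α * N 3
        W·du·dx≤fα*N3 = begin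
          W S * ℕ→ℚ (deg G u) * ℕ→ℚ (deg G x)
            ≤⟨ *-mono-≤-0≤ (*-nonNeg (W-nonNeg S) (ℕ→ℚ-nonNeg (deg G u)))
                 (*-mono-≤-0≤ (W-nonNeg S) (W≤ν*fα S) (ℕ→ℚ-nonNeg (deg G u)) (ℕ→ℚ-mono-≤ (deg≤n u)))
                 (ℕ→ℚ-nonNeg (deg G x)) (ℕ→ℚ-mono-≤ (deg≤n x)) ⟩
          ν * f α * ν * ν     ≡⟨ solve 2 (λ v a → v :* a :* v :* v := a :* (v :* (v :* (v :* con 1ℚ)))) refl ν (f α) ⟩
          f α * (ν * (ν * (ν * 1ℚ)))  ≡⟨ cong (f α *_) N3≡ν³ ⟨
          f α * N 3 ∎

      flux≡ : flux S u x ≡ (f α - f (lookup S x)) * (inv (W S) * c u * c x)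
      flux≡ = begin
        flux S u x
          ≡⟨ flux-formula S u x ⟩
        inv (W S) * c u * c x * ((χ S u - χ S x) * (f (lookup S u) - f (lookup S x)))
          ≡⟨ cong₂ (λ a b → inv (W S) * c u * c x * ((a - b) * (f (lookup S u) - f (lookup S x)))) (χ≡1 S S[u]≡α) (χ≡0 S S[x]≢α) ⟩
        inv (W S) * c u * c x * ((1ℚ - 0ℚ) * (f (lookup S u) - f (lookup S x)))
          ≡⟨ cong (λ a → inv (W S) * c u * c x * ((1ℚ - 0ℚ) * (f a - f (lookup S x)))) S[u]≡α ⟩
        inv (W S) * c u * c x * ((1ℚ - 0ℚ) * (f α - f (lookup S x)))
          ≡⟨ solve 2 (λ p d → p :* ((con 1ℚ :- con 0ℚ) :* d) := d :* p) refl (inv (W S) * c u * c x) (f α - f (lookup S x)) ⟩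
        (f α - f (lookup S x)) * (inv (W S) * c u * c x) ∎
        where open ≡-Reasoning

      rate·Δ²≡ : rate S u * (Δ S u x * Δ S u x) ≡ f α * (inv (W S) * c u * c x) * c x
      rate·Δ²≡ = begin
        f (lookup S u) * inv (W S) * c u * ((χ S u - χ S x) * c x * ((χ S u - χ S x) * c x))
          ≡⟨ cong₂ (λ a b → f a * inv (W S) * c u * ((b - χ S x) * c x * ((b - χ S x) * c x))) S[u]≡α (χ≡1 S S[u]≡α) ⟩
        f α * inv (W S) * c u * ((1ℚ - χ S x) * c x * ((1ℚ - χ S x) * c x))
          ≡⟨ cong (λ b → f α * inv (W S) * c u * ((1ℚ - b) * c x * ((1ℚ - b) * c x))) (χ≡0 S S[x]≢α) ⟩
        f α * inv (W S) * c u * ((1ℚ - 0ℚ) * c x * ((1ℚ - 0ℚ) * c x))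
          ≡⟨ solve 4 (λ a i p q → a :* i :* p :* ((con 1ℚ :- con 0ℚ) :* q :* ((con 1ℚ :- con 0ℚ) :* q)) := a :* (i :* p :* q) :* q) refl
               (f α) (inv (W S)) (c u) (c x) ⟩
        f α * (inv (W S) * c u * c x) * c x ∎
        where open ≡-Reasoning

    module LinearPotential (γ : ℚ) (0<γ : 0ℚ < γ) (gap : ∀ j → j ≢ α → γ ≤ f α - f j) where

      g : State n k → ℚ
      g S = ν - φ S

      δ : ℚ
      δ = γ * inv (f α * N 3)

      0≤g : ∀ S → 0ℚ ≤ g S
      0≤g S = p≤q⇒0≤q-p (φ≤n S)

      g-update : ∀ S v w → g (update S v w) ≡ g S - Δ S v w
      g-update S v w = ≡-trans (cong (λ p → ν - p) (φ-update S v w))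
        (solve 3 (λ a b d → a :- (b :+ d) := a :- b :- d) refl ν (φ S) (Δ S v w))

      drift : ∀ S → absorbed α S ≡ false → Σ[ allVecs k n ] (λ S′ → trans G f S S′ * g S′) + δ ≤ g S
      drift S alive = from-edge (boundary-edge α G conn S alive)
        where
        from-edge : (∃₂ λ u x → T (adj G u x) × lookup S u ≡ α × lookup S x ≢ α) →
                    Σ[ allVecs k n ] (λ S′ → trans G f S S′ * g S′) + δ ≤ g S
        from-edge (u , x , u~x , S[u]≡α , S[x]≢α) =
          drift-from-decrease g Δ g-update S (0≤g S) (≤-trans δ≤flux (flux≤E[Δ] αmax S u~x u≢x))
          where
          open Boundary S u~x S[u]≡α S[x]≢α
          δ≤flux : δ ≤ flux S u x
          δ≤flux = subst (δ ≤_) (sym flux≡) (*-mono-≤-0≤ (<⇒≤ 0<γ) (gap (lookup S x) S[x]≢α)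
                     (inv-nonNeg (*-nonNeg (<⇒≤ 0<fα) (<⇒≤ (0<N 3)))) inv[fα*n³]≤inv[W]*c*c)

      δ*B≡ν : δ * ((f α ÷₀ γ) * N 4) ≡ ν
      δ*B≡ν = begin
        γ * inv (f α * N 3) * ((f α ÷₀ γ) * N 4)
          ≡⟨ cong₂ (λ a b → γ * inv (f α * N 3) * (a * b)) (÷₀≡*inv (f α) γ) (N-suc 3) ⟩
        γ * inv (f α * N 3) * (f α * inv γ * (ν * N 3))
          ≡⟨ solve 6 (λ g i a j v n3 → g :* i :* (a :* j :* (v :* n3)) := (a :* n3 :* i) :* (g :* j) :* v) refl
               γ (inv (f α * N 3)) (f α) (inv γ) ν (N 3) ⟩
        (f α * N 3 * inv (f α * N 3)) * (γ * inv γ) * ν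
          ≡⟨ cong₂ (λ a b → a * b * ν) (*-inv (pos⇒≢0 (*-pos 0<fα (0<N 3)))) (*-inv (pos⇒≢0 0<γ)) ⟩
        1ℚ * 1ℚ * ν
          ≡⟨ *-identityˡ ν ⟩
        ν ∎
        where open ≡-Reasoning

      expectedAbsorption≤ : ExpA≤ G f D α ((f α ÷₀ γ) * N 4)
      expectedAbsorption≤ =
        Drift.expectedAbsorption≤ G f f≥0 D D-dist α g ν δ 0≤g (λ S → q-p≤q ν (φ-nonNeg S)) drift
          ((f α ÷₀ γ) * N 4) (*-pos 0<γ (inv-pos (*-pos 0<fα (0<N 3)))) (≤-reflexive (sym δ*B≡ν))

    module QuadraticPotential where

      g : State n k → ℚ
      g S = ν * ν - φ S * φ S

      F : State n k → Fin n → Fin n → ℚ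
      F S v w = (φ S + φ S) * Δ S v w + Δ S v w * Δ S v w

      δ : ℚ
      δ = f α * inv (f α * N 3) * inv ν

      0<δ : 0ℚ < δ
      0<δ = *-pos (*-pos 0<fα (inv-pos (*-pos 0<fα (0<N 3)))) (inv-pos 0<ν)

      0≤g : ∀ S → 0ℚ ≤ g S
      0≤g S = p≤q⇒0≤q-p (*-mono-≤-0≤ (φ-nonNeg S) (φ≤n S) (φ-nonNeg S) (φ≤n S))

      g-update : ∀ S v w → g (update S v w) ≡ g S - F S v w
      g-update S v w = ≡-trans (cong (λ p → ν * ν - p * p) (φ-update S v w))
        (solve 3 (λ v p d → v :* v :- (p :+ d) :* (p :+ d) := v :* v :- p :* p :- ((p :+ p) :* d :+ d :* d)) refl ν (φ S) (Δ S v w))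

      E[F]≡ : ∀ S → E[ S ] (F S) ≡ (φ S + φ S) * E[ S ] (Δ S) + E[ S ] (λ v w → Δ S v w * Δ S v w)
      E[F]≡ S = ≡-trans (E-+ S _ _) (cong (_+ E[ S ] (λ v w → Δ S v w * Δ S v w)) (E-*ˡ S (φ S + φ S) (Δ S)))

      drift : ∀ S → absorbed α S ≡ false → Σ[ allVecs k n ] (λ S′ → trans G f S S′ * g S′) + δ ≤ g S
      drift S alive = from-edge (boundary-edge α G conn S alive)
        where
        from-edge : (∃₂ λ u x → T (adj G u x) × lookup S u ≡ α × lookup S x ≢ α) →
                    Σ[ allVecs k n ] (λ S′ → trans G f S S′ * g S′) + δ ≤ g S
        from-edge (u , x , u~x , S[u]≡α , S[x]≢α) = drift-from-decrease g F g-update S (0≤g S) (begin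
          δ                                               ≤⟨ δ≤rate·Δ² ⟩
          rate S u * (Δ S u x * Δ S u x)                  ≤⟨ rate·Δ²≤E[Δ²] S u~x ⟩
          E[ S ] (λ v w → Δ S v w * Δ S v w)              ≤⟨ p≤q+p (*-nonNeg (+-mono-≤ (φ-nonNeg S) (φ-nonNeg S)) (E[Δ]-nonNeg αmax S)) ⟩
          (φ S + φ S) * E[ S ] (Δ S) + E[ S ] (λ v w → Δ S v w * Δ S v w)  ≡⟨ E[F]≡ S ⟨
          E[ S ] (F S)                                    ∎)
          where
          open ≤-Reasoning
          open Boundary S u~x S[u]≡α S[x]≢α
          δ≤rate·Δ² : δ ≤ rate S u * (Δ S u x * Δ S u x)
          δ≤rate·Δ² = subst (δ ≤_) (sym rate·Δ²≡)
            (*-mono-≤-0≤ (*-nonNeg (<⇒≤ 0<fα) (inv-nonNeg (*-nonNeg (<⇒≤ 0<fα) (<⇒≤ (0<N 3)))))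
                         (*-monoˡ-≤-0≤ (<⇒≤ 0<fα) inv[fα*n³]≤inv[W]*c*c)
                         (inv-nonNeg (<⇒≤ 0<ν)) (inv-ν≤c x~u))

      δ*N6≡ν² : δ * N 6 ≡ ν * ν
      δ*N6≡ν² = begin
        f α * inv (f α * N 3) * inv ν * N 6
          ≡⟨ cong (f α * inv (f α * N 3) * inv ν *_) N6≡ν³*N3 ⟩
        f α * inv (f α * N 3) * inv ν * (ν * (ν * (ν * N 3)))
          ≡⟨ solve 5 (λ a i j v n3 → a :* i :* j :* (v :* (v :* (v :* n3))) := (a :* n3 :* i) :* (v :* j) :* (v :* v)) refl
               (f α) (inv (f α * N 3)) (inv ν) ν (N 3) ⟩
        (f α * N 3 * inv (f α * N 3)) * (ν * inv ν) * (ν * ν)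
          ≡⟨ cong₂ (λ a b → a * b * (ν * ν)) (*-inv (pos⇒≢0 (*-pos 0<fα (0<N 3)))) (*-inv (pos⇒≢0 0<ν)) ⟩
        1ℚ * 1ℚ * (ν * ν)
          ≡⟨ *-identityˡ (ν * ν) ⟩
        ν * ν ∎
        where
        open ≡-Reasoning
        N6≡ν³*N3 : N 6 ≡ ν * (ν * (ν * N 3))
        N6≡ν³*N3 = ≡-trans (N-suc 5) (cong (ν *_) (≡-trans (N-suc 4) (cong (ν *_) (N-suc 3))))

      expectedAbsorption≤ : ExpA≤ G f D α (N 6)
      expectedAbsorption≤ =
        Drift.expectedAbsorption≤ G f f≥0 D D-dist α g (ν * ν) δ 0≤g (λ S → q-p≤q (ν * ν) (0≤p*p (φ S))) drift
          (N 6) 0<δ (≤-reflexive (sym δ*N6≡ν²))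

  ExpA≤-mono : ∀ {n k} {G : Graph n} {f : Fin k → ℚ} {D α B B′} → B ≤ B′ → ExpA≤ G f D α B → ExpA≤ G f D α B′
  ExpA≤-mono B≤B′ E≤B T = ≤-trans (E≤B T) B≤B′

  -- Every state on no vertices is absorbed, so the zero potential drifts down by 1.
  ExpA≤-empty : ∀ {k} (G : Graph 0) (f : Fin k → ℚ) → (∀ j → 0ℚ ≤ f j) →
                ∀ D → IsDistribution D → ∀ α {B} → 0ℚ ≤ B → ExpA≤ G f D α B
  ExpA≤-empty G f f≥0 D D-dist α 0≤B =
    Drift.expectedAbsorption≤ G f f≥0 D D-dist α (λ _ → 0ℚ) 0ℚ 1ℚ (λ _ → ≤-refl) (λ _ → ≤-refl)
      (λ { Vec.[] () }) _ 0<1 (subst (0ℚ ≤_) (sym (*-identityˡ _)) 0≤B)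

  bound : ℕ → ℕ → ℚ → ℚ
  bound m n q = ℕ→ℚ ((m ∸ 1) ℕ.* n ^ 6) + q * ℕ→ℚ (suc n ℕ.* n ^ 3)

  0≤bound : ∀ m n {q} → 0ℚ ≤ q → 0ℚ ≤ bound m n q
  0≤bound m n 0≤q = +-mono-≤ (ℕ→ℚ-nonNeg ((m ∸ 1) ℕ.* n ^ 6)) (*-nonNeg 0≤q (ℕ→ℚ-nonNeg (suc n ℕ.* n ^ 3)))

  n⁶≤bound : ∀ m n {q} → 2 ℕ.≤ m → 0ℚ ≤ q → ℕ→ℚ (n ^ 6) ≤ bound m n q
  n⁶≤bound (suc (suc m)) n _ 0≤q = ≤-trans (ℕ→ℚ-mono-≤ (ℕP.m≤m+n (n ^ 6) (m ℕ.* n ^ 6)))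
    (p≤p+q (*-nonNeg 0≤q (ℕ→ℚ-nonNeg (suc n ℕ.* n ^ 3))))
  n⁶≤bound (suc zero) n (s≤s ()) _

  q*n⁴≤bound : ∀ m n {q} → 0ℚ ≤ q → q * ℕ→ℚ (n ^ 4) ≤ bound m n q
  q*n⁴≤bound m n 0≤q = ≤-trans (*-monoˡ-≤-0≤ 0≤q (ℕ→ℚ-mono-≤ (ℕP.m≤n+m (n ℕ.* n ^ 3) (n ^ 3))))
    (p≤q+p (ℕ→ℚ-nonNeg ((m ∸ 1) ℕ.* n ^ 6)))

  another-maximum? : ∀ {k} (f : Fin k → ℚ) (α : Fin k) →
                     (∃ λ β → β ≢ α × f β ≡ fmax f) ⊎ (∀ β → β ≢ α → f β ≢ fmax f)
  another-maximum? f α with any? (λ β → ¬? (β Fin.≟ α) ×-dec (f β ≟ fmax f))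
  ... | yes another = inj₁ another
  ... | no  none    = inj₂ (λ β β≢α βmax → none (β , β≢α , βmax))

  module _ {k : ℕ} (f : Fin k → ℚ) {α : Fin k} (αmax : InTauMax f α) where

    tauMax⇒max : ∀ j → f j ≤ f α
    tauMax⇒max j = subst (f j ≤_) (sym αmax) (fmax-ub f j)

    0<fα-fstar : (∃ λ j → f j ≢ fmax f) → 0ℚ < f α - fstar f
    0<fα-fstar nonmax = subst (0ℚ <_) (cong (_- fstar f) (sym αmax))
      (subst (_< fmax f - fstar f) (+-inverseʳ (fstar f)) (+-monoˡ-< (- fstar f) (fstar<fmax f nonmax)))

    0≤fα÷₀[fα-fstar] : 0ℚ ≤ f α → (∃ λ j → f j ≢ fmax f) → 0ℚ ≤ f α ÷₀ (f α - fstar f)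
    0≤fα÷₀[fα-fstar] 0≤fα nonmax = subst (0ℚ ≤_) (sym (÷₀≡*inv (f α) (f α - fstar f)))
      (*-nonNeg 0≤fα (inv-nonNeg (<⇒≤ (0<fα-fstar nonmax))))

    unique-max-gap : (∀ β → β ≢ α → f β ≢ fmax f) → ∀ j → j ≢ α → f α - fstar f ≤ f α - f j
    unique-max-gap unique j j≢α = +-monoʳ-≤ (f α) (neg-antimono-≤ (fstar-ub f j (unique j j≢α)))

open import Defs
open import Data.Nat as ℕ using (ℕ; _≤_; _^_; _∸_; suc)
open import Data.Fin using (Fin)
open import Data.List using (length)
open import Data.Product using (∃; _×_)
open import Data.Rational using (ℚ; 1ℚ; _+_; _*_; _-_)
open import Relation.Binary.PropositionalEquality using (_≢_)

open import Data.Nat using (zero)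
open import Data.Product using (_,_)
open import Data.Sum using ([_,_]′)
import Data.Rational.Properties as ℚP
open import Function using (_∘_)
open import Relation.Binary.PropositionalEquality using (_≡_; sym)
open Absorption

corollary20 : (n k : ℕ) (G : Graph n) → Connected G → 2 ≤ k →
    (f : Fin k → ℚ) → (∀ j → 1ℚ Data.Rational.≤ f j) →
    (D : State n k → ℚ) → IsDistribution D → InCalD D →
    (∃ λ j → f j ≢ fmax f) →
    (α : Fin k) → InTauMax f α →
    ExpA≤ G f D α
      (ℕ→ℚ ((length (tauMaxList f) ∸ 1) ℕ.* n ^ 6)
       + (f α ÷₀ (f α - fstar f)) * ℕ→ℚ (suc n ℕ.* n ^ 3))
corollary20 n k G conn _ f f≥1 D D-dist _ nonmax α αmax = by-size n G conn D D-dist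
  where
  f≥0 : ∀ j → Data.Rational.0ℚ Data.Rational.≤ f j
  f≥0 j = ℚP.≤-trans 0≤1 (f≥1 j)
  0<fα : Data.Rational.0ℚ Data.Rational.< f α
  0<fα = ℚP.<-≤-trans 0<1 (f≥1 α)
  0≤q : Data.Rational.0ℚ Data.Rational.≤ f α ÷₀ (f α - fstar f)
  0≤q = 0≤fα÷₀[fα-fstar] f αmax (f≥0 α) nonmax
  claimed : ℕ → ℚ
  claimed n = bound (length (tauMaxList f)) n (f α ÷₀ (f α - fstar f))
  by-size : ∀ n (G : Graph n) → Connected G → (D : State n k → ℚ) → IsDistribution D →
            ExpA≤ G f D α (claimed n)
  by-size zero G _ D D-dist = ExpA≤-empty G f f≥0 D D-dist α (0≤bound (length (tauMaxList f)) 0 0≤q)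
  by-size (suc n) G conn D D-dist = [ shared-maximum , unique-maximum ]′ (another-maximum? f α)
    where
    shared-maximum : (∃ λ β → β ≢ α × f β ≡ fmax f) → ExpA≤ G f D α (claimed (suc n))
    shared-maximum (β , β≢α , βmax) =
      ExpA≤-mono (n⁶≤bound (length (tauMaxList f)) (suc n) (two-maxima⇒2≤|τmax| f (β≢α ∘ sym) αmax βmax) 0≤q)
        (MaxFitness.QuadraticPotential.expectedAbsorption≤ G conn f f≥0 α 0<fα (tauMax⇒max f αmax) D D-dist)
    unique-maximum : (∀ β → β ≢ α → f β ≢ fmax f) → ExpA≤ G f D α (claimed (suc n))
    unique-maximum unique =
      ExpA≤-mono (q*n⁴≤bound (length (tauMaxList f)) (suc n) 0≤q)
        (MaxFitness.LinearPotential.expectedAbsorption≤ G conn f f≥0 α 0<fα (tauMax⇒max f αmax) D D-dist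
          (f α - fstar f) (0<fα-fstar f αmax nonmax) (unique-max-gap f αmax unique))
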